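{- Let $K$ be a field, $T\in K^{m\times n\times p}$ with slices $T_1,\ldots,T_p\in M_{m,n}(K)$, and let $A_1,\ldots,A_p$ be the $(m+n)\times(m+n)$ matrices $A_i=\begin{pmatrix}0_{m\times m}&T_i\\0_{n\times m}&0_{n\times n}\end{pmatrix}$. Let $s$ be the smallest size of a commuting extension of $(A_1,\ldots,A_p)$ consisting of diagonalizable matrices. Then $s=\mathrm{rank}(T)+m+n$.
   Context: Slices $T_k=(T_{ijk})_{i,j}$; tensor rank is the least number of tensors $u\otimes v\otimes w$ (entries $u_iv_jw_k$) summing to $T$. A commuting extension of size $s$ of $(A_1,\ldots,A_p)$ is a tuple of pairwise commuting $s\times s$ matrices $Z_i$ whose top-left $(m+n)\times(m+n)$ block is $A_i$. -}

module Defs where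

open import Level using (Level; _⊔_) renaming (suc to lsuc)
open import Data.Nat using (ℕ; zero; suc; _≤_) renaming (_+_ to _+ℕ_)
open import Data.Fin using (Fin; zero; suc; splitAt; inject≤)
open import Data.Sum using (_⊎_; inj₁; inj₂)
open import Data.Product using (Σ; _×_; _,_; ∃)
open import Relation.Binary.PropositionalEquality using (_≡_)
open import Relation.Nullary using (¬_)
open import Algebra.Bundles using (CommutativeRing)

record Field c ℓ : Set (lsuc (c ⊔ ℓ)) where
  field
    commutativeRing : CommutativeRing c ℓ
  open CommutativeRing commutativeRing public
  field
    0≉1     : ¬ (0# ≈ 1#)
    inverse : ∀ x → ¬ (x ≈ 0#) → Σ Carrier (λ y → x * y ≈ 1#)

module FieldDefs {c ℓ} (K : Field c ℓ) where
  open Field K using (Carrier; _≈_; _+_; _*_; 0#; 1#)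

  ∑ : ∀ {k} → (Fin k → Carrier) → Carrier
  ∑ {zero}  f = 0#
  ∑ {suc k} f = f zero + ∑ (λ i → f (suc i))

  Mat : ℕ → ℕ → Set c
  Mat a b = Fin a → Fin b → Carrier

  _≈ᴹ_ : ∀ {a b} → Mat a b → Mat a b → Set ℓ
  M ≈ᴹ N = ∀ i j → M i j ≈ N i j

  _·_ : ∀ {a b d} → Mat a b → Mat b d → Mat a d
  (M · N) i j = ∑ (λ k → M i k * N k j)

  δ : ∀ {a} → Fin a → Fin a → Carrier
  δ zero    zero    = 1#
  δ zero    (suc j) = 0#
  δ (suc i) zero    = 0#
  δ (suc i) (suc j) = δ i j

  I : ∀ {a} → Mat a a
  I = δ

  Diagonal : ∀ {a} → Mat a a → Set ℓ
  Diagonal D = ∀ i j → ¬ (i ≡ j) → D i j ≈ 0#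

  Diagonalizable : ∀ {a} → Mat a a → Set (c ⊔ ℓ)
  Diagonalizable {a} Z =
    Σ (Mat a a) λ P → Σ (Mat a a) λ Q → Σ (Mat a a) λ D →
      ((P · Q) ≈ᴹ I) × ((Q · P) ≈ᴹ I) × Diagonal D × (Z ≈ᴹ ((P · D) · Q))

  Tensor : ℕ → ℕ → ℕ → Set c
  Tensor m n p = Fin m → Fin n → Fin p → Carrier

  HasDecomposition : ∀ {m n p} → Tensor m n p → ℕ → Set (c ⊔ ℓ)
  HasDecomposition {m} {n} {p} T r =
    Σ (Fin r → Fin m → Carrier) λ u →
    Σ (Fin r → Fin n → Carrier) λ v →
    Σ (Fin r → Fin p → Carrier) λ w →
      ∀ i j k → T i j k ≈ ∑ (λ l → (u l i * v l j) * w l k)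

  IsTensorRank : ∀ {m n p} → Tensor m n p → ℕ → Set (c ⊔ ℓ)
  IsTensorRank T r = HasDecomposition T r × (∀ r′ → HasDecomposition T r′ → r ≤ r′)

  blockA : ∀ {m n p} → Tensor m n p → Fin p → Mat (m +ℕ n) (m +ℕ n)
  blockA {m} T k i j with splitAt m i | splitAt m j
  ... | inj₁ a | inj₂ b = T a b k
  ... | _      | _      = 0#

  DiagCommExt : ∀ {q p} → (Fin p → Mat q q) → ℕ → Set (c ⊔ ℓ)
  DiagCommExt {q} {p} A s =
    Σ (q ≤ s) λ q≤s → Σ (Fin p → Mat s s) λ Z →
      (∀ k l → (Z k · Z l) ≈ᴹ (Z l · Z k)) ×
      (∀ k → Diagonalizable (Z k)) ×
      (∀ k i j → Z k (inject≤ i q≤s) (inject≤ j q≤s) ≈ A k i j)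

-- Upper bound: if T = ∑ₗ uₗ ⊗ vₗ ⊗ wₗ with r terms, let X̃ have columns (uₗ, 0) and Ỹ rows
-- (0, vₗ), so that X̃ diag(w k) Ỹ = A k. Conjugating the diagonal matrices diag(0, w k) of size
-- m + n + r by a unipotent P whose off-diagonal blocks are X̃ and Ỹ gives a commuting
-- diagonalizable extension of (A k).
--
-- Lower bound: commuting diagonalizable matrices Z k of size s are simultaneously
-- diagonalizable, Z k = X Λ k X⁻¹, so the tensor with slices I, Z 1, …, Z p has rank at most s,
-- and so has its top-left block, with slices I, A 1, …, A p. In that tensor the last n rows and
-- then the first m columns are unit vectors of the identity slice; the substitution method
-- removes each of them at the cost of one term and leaves a decomposition of T. Hence
-- s ≥ m + n + rank T.
--
-- Equality in K need not be decidable, so the diagonalization is carried out under double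
-- negation, where finitely many equalities can be decided; the final inequality of natural
-- numbers is decidable and hence stable. Frames of common eigenvectors are refined one matrix at a
-- time using the projectors onto joint eigenspaces, and redundant vectors are then dropped until
-- the frame is a basis.

module Submission where

open import Defs
open import Level using (_⊔_)
open import Data.Nat as ℕ using (ℕ; zero; suc)
import Data.Nat.Properties as ℕ
import Data.Fin.Properties as Fin
open import Data.Fin as Fin using (Fin; zero; suc; punchIn; _↑ˡ_; _↑ʳ_)
open import Data.Product using (Σ; _×_; _,_; ∃; proj₁; proj₂; uncurry)
open import Data.Vec.Functional using (_∷_; _++_)
open import Function using (_∘_; id)
open import Data.Sum as Sum using (inj₁; inj₂; [_,_]′)
open import Relation.Nullary.Decidable using (decidable-stable; ¬¬-excluded-middle)
open import Relation.Nullary using (¬_; Dec; yes; no; contradiction)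
open import Relation.Nullary.Negation using (DoubleNegation)
open import Relation.Binary.PropositionalEquality as ≡ using (_≡_; _≢_)
open import Function.Definitions using (Injective)
import Algebra.Properties.Ring as RingProperties
import Algebra.Properties.Semiring.Sum as SemiringSum
import Algebra.Properties.CommutativeSemigroup as CommutativeSemigroupProperties
import Relation.Binary.Reasoning.Setoid
open import Relation.Binary.Bundles using (Setoid)

-- Bind of the double-negation monad, at mixed universe levels (unlike ¬¬-Monad).
infixl 1 _>>=_
_>>=_ : ∀ {a b} {A : Set a} {B : Set b} → DoubleNegation A → (A → DoubleNegation B) → DoubleNegation B
(¬¬a >>= f) ¬b = ¬¬a (λ a → f a ¬b)

return : ∀ {a} {A : Set a} → A → DoubleNegation A
return a ¬a = ¬a a

¬¬-∀-Fin : ∀ {p} {n} {P : Fin n → Set p} → (∀ i → DoubleNegation (P i)) → DoubleNegation (∀ i → P i)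
¬¬-∀-Fin {n = zero}  ¬¬P ¬∀ = ¬∀ (λ ())
¬¬-∀-Fin {n = suc n} ¬¬P = do
  P₀ ← ¬¬P zero
  P₊ ← ¬¬-∀-Fin (¬¬P ∘ suc)
  return λ { zero → P₀ ; (suc i) → P₊ i }

¬∀⇒¬¬∃¬ : ∀ {p} {n} {P : Fin n → Set p} → ¬ (∀ i → P i) → DoubleNegation (∃ λ i → ¬ P i)
¬∀⇒¬¬∃¬ ¬∀ ¬∃ = ¬¬-∀-Fin (λ i ¬Pi → ¬∃ (i , ¬Pi)) ¬∀

-- The least index satisfying P, provided P i holds (i bounds the search).
first : ∀ {r n} {P : Fin n → Set r} → (∀ i → Dec (P i)) → Fin n → Fin n
first P? zero    = zero
first P? (suc i) with P? zero
... | yes _ = zero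
... | no  _ = suc (first (P? ∘ suc) i)

first-satisfies : ∀ {r n} {P : Fin n → Set r} (P? : ∀ i → Dec (P i)) {i} → P i → P (first P? i)
first-satisfies P? {zero}  Pᵢ = Pᵢ
first-satisfies P? {suc i} Pᵢ with P? zero
... | yes P₀ = P₀
... | no  _  = first-satisfies (P? ∘ suc) Pᵢ

first-cong : ∀ {r n} {P Q : Fin n → Set r} (P? : ∀ i → Dec (P i)) (Q? : ∀ i → Dec (Q i)) →
             (∀ k → P k → Q k) → (∀ k → Q k → P k) → ∀ {i j} → P i → Q j → first P? i ≡ first Q? j
first-cong P? Q? P⇒Q Q⇒P {zero}  {zero}  _  _  = ≡.refl
first-cong P? Q? P⇒Q Q⇒P {zero}  {suc j} P₀ _ with Q? zero
... | yes _  = ≡.refl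
... | no ¬Q₀ = contradiction (P⇒Q zero P₀) ¬Q₀
first-cong P? Q? P⇒Q Q⇒P {suc i} {zero}  _ Q₀ with P? zero
... | yes _  = ≡.refl
... | no ¬P₀ = contradiction (Q⇒P zero Q₀) ¬P₀
first-cong P? Q? P⇒Q Q⇒P {suc i} {suc j} Pᵢ Qⱼ with P? zero | Q? zero
... | yes _  | yes _  = ≡.refl
... | yes P₀ | no ¬Q₀ = contradiction (P⇒Q zero P₀) ¬Q₀
... | no ¬P₀ | yes Q₀ = contradiction (Q⇒P zero Q₀) ¬P₀
... | no _   | no _   = ≡.cong suc (first-cong (P? ∘ suc) (Q? ∘ suc) (P⇒Q ∘ suc) (Q⇒P ∘ suc) Pᵢ Qⱼ)

↑ʳ≢↑ˡ : ∀ {m n} (b : Fin n) (a : Fin m) → m ↑ʳ b ≢ a ↑ˡ n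
↑ʳ≢↑ˡ {m} {n} b a eq with ≡.trans (≡.sym (Fin.splitAt-↑ʳ m n b)) (≡.trans (≡.cong (Fin.splitAt m) eq) (Fin.splitAt-↑ˡ m a n))
... | ()

inject≤≡↑ˡ : ∀ {a} b (x : Fin a) → Fin.inject≤ x (ℕ.m≤m+n a b) ≡ x ↑ˡ b
inject≤≡↑ˡ {a} b x = Fin.toℕ-injective (≡.trans (Fin.toℕ-inject≤ x (ℕ.m≤m+n a b)) (≡.sym (Fin.toℕ-↑ˡ x b)))

module _ {c ℓ} (K : Field c ℓ) where
  open Field K hiding (zero)
  open FieldDefs K
  open RingProperties ring using (x∙y⁻¹≈ε⇒x≈y; -0#≈0#; -1*x≈-x; x[y-z]≈xy-xz; [y-z]x≈yx-zx)
  open CommutativeSemigroupProperties *-commutativeSemigroup using (x∙yz≈y∙xz; x∙yz≈z∙xy; xy∙z≈xz∙y; xy∙z≈y∙xz)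
  open SemiringSum semiring
    using (sum; sum-syntax; sum-cong-≋; sum-cong-≗; ∑-distrib-+; ∑-comm; sum-remove; *-distribˡ-sum; *-distribʳ-sum; sum-replicate-zero)
  module ≈-Reasoning = Relation.Binary.Reasoning.Setoid setoid

  *-cancelˡ-≉0 : ∀ {x y z} → ¬ x ≈ 0# → x * y ≈ x * z → y ≈ z
  *-cancelˡ-≉0 {x} {y} {z} x≉0 xy≈xz = begin
    y              ≈⟨ cancel y ⟨
    x⁻¹ * (x * y)  ≈⟨ *-congˡ xy≈xz ⟩
    x⁻¹ * (x * z)  ≈⟨ cancel z ⟩
    z              ∎
    where
    open ≈-Reasoning
    x⁻¹ = proj₁ (inverse x x≉0)
    cancel : ∀ w → x⁻¹ * (x * w) ≈ w
    cancel w = trans (sym (*-assoc x⁻¹ x w)) (trans (*-congʳ (trans (*-comm x⁻¹ x) (proj₂ (inverse x x≉0)))) (*-identityˡ w))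

  x-y*z≈x : ∀ x y {z} → z ≈ 0# → x - y * z ≈ x
  x-y*z≈x x y {z} z≈0 = begin
    x - y * z  ≈⟨ +-congˡ (-‿cong (trans (*-congˡ z≈0) (zeroʳ y))) ⟩
    x - 0#     ≈⟨ +-congˡ -0#≈0# ⟩
    x + 0#     ≈⟨ +-identityʳ x ⟩
    x          ∎
    where open ≈-Reasoning

  ∑≡sum : ∀ {n} (f : Fin n → Carrier) → ∑ f ≡ sum f
  ∑≡sum {zero}  f = ≡.refl
  ∑≡sum {suc n} f = ≡.cong (f zero +_) (∑≡sum (f ∘ suc))

  ∑-zero : ∀ {n} {f : Fin n → Carrier} → (∀ i → f i ≈ 0#) → ∑[ i < n ] f i ≈ 0#
  ∑-zero {n} f≈0 = trans (sum-cong-≋ f≈0) (sum-replicate-zero n)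

  ∑-sub : ∀ n (f g : Fin n → Carrier) → ∑[ i < n ] (f i - g i) ≈ ∑[ i < n ] f i - ∑[ i < n ] g i
  ∑-sub n f g = begin
    ∑[ i < n ] (f i - g i)                 ≈⟨ ∑-distrib-+ {n} f _ ⟩
    ∑[ i < n ] f i + ∑[ i < n ] (- g i)    ≈⟨ +-congˡ (sum-cong-≋ {n} (λ i → -1*x≈-x (g i))) ⟨
    ∑[ i < n ] f i + ∑[ i < n ] (- 1# * g i) ≈⟨ +-congˡ (*-distribˡ-sum {n} (- 1#) g) ⟨
    ∑[ i < n ] f i + - 1# * ∑[ i < n ] g i ≈⟨ +-congˡ (-1*x≈-x _) ⟩
    ∑[ i < n ] f i - ∑[ i < n ] g i        ∎
    where open ≈-Reasoning

  δ-diag : ∀ {n} (i : Fin n) → δ i i ≈ 1#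
  δ-diag zero    = refl
  δ-diag (suc i) = δ-diag i

  δ-off : ∀ {n} {i j : Fin n} → i ≢ j → δ i j ≈ 0#
  δ-off {i = zero}  {zero}  i≢j = contradiction ≡.refl i≢j
  δ-off {i = zero}  {suc j} i≢j = refl
  δ-off {i = suc i} {zero}  i≢j = refl
  δ-off {i = suc i} {suc j} i≢j = δ-off (i≢j ∘ ≡.cong suc)

  δ-sym : ∀ {n} (i j : Fin n) → δ i j ≈ δ j i
  δ-sym zero    zero    = refl
  δ-sym zero    (suc j) = refl
  δ-sym (suc i) zero    = refl
  δ-sym (suc i) (suc j) = δ-sym i j

  δ-injective : ∀ {m n} {h : Fin m → Fin n} → Injective _≡_ _≡_ h → ∀ i j → δ (h i) (h j) ≈ δ i j
  δ-injective {h = h} h-inj i j with i Fin.≟ j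
  ... | yes ≡.refl = trans (δ-diag (h i)) (sym (δ-diag i))
  ... | no i≢j     = trans (δ-off (i≢j ∘ h-inj)) (sym (δ-off i≢j))

  δ-idempotent : ∀ {n} (i j : Fin n) → δ i j * δ i j ≈ δ i j
  δ-idempotent zero    zero    = *-identityˡ 1#
  δ-idempotent zero    (suc j) = zeroˡ 0#
  δ-idempotent (suc i) zero    = zeroˡ 0#
  δ-idempotent (suc i) (suc j) = δ-idempotent i j

  ∑-δˡ : ∀ {n} (i : Fin n) (f : Fin n → Carrier) → ∑[ j < n ] (δ i j * f j) ≈ f i
  ∑-δˡ {suc n} zero f = trans (+-cong (*-identityˡ _) (∑-zero {n} (λ j → zeroˡ (f (suc j))))) (+-identityʳ _)
  ∑-δˡ {suc n} (suc i) f = trans (+-congʳ (zeroˡ _)) (trans (+-identityˡ _) (∑-δˡ i (f ∘ suc)))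

  ∑-δʳ : ∀ {n} (i : Fin n) (f : Fin n → Carrier) → ∑[ j < n ] (f j * δ j i) ≈ f i
  ∑-δʳ i f = trans (sum-cong-≋ (λ j → trans (*-comm _ _) (*-congʳ (δ-sym j i)))) (∑-δˡ i f)

  ∑-split : ∀ a {b} (f : Fin (a ℕ.+ b) → Carrier) →
            ∑[ x < a ℕ.+ b ] f x ≈ ∑[ i < a ] f (i ↑ˡ b) + ∑[ j < b ] f (a ↑ʳ j)
  ∑-split zero    f = sym (+-identityˡ _)
  ∑-split (suc a) f = trans (+-congˡ (∑-split a (f ∘ suc))) (sym (+-assoc _ _ _))

  ∑-combine : ∀ a {b} (f : Fin (a ℕ.* b) → Carrier) →
              ∑[ x < a ℕ.* b ] f x ≈ ∑[ i < a ] ∑[ j < b ] f (Fin.combine i j)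
  ∑-combine zero    f = refl
  ∑-combine (suc a) {b} f = trans (∑-split b f) (+-congˡ (∑-combine a (f ∘ (b ↑ʳ_))))

  -- Opaque because unfolding products into sums makes type checking several times slower.
  infixl 30 _⊙_
  opaque
    _⊙_ : ∀ {a b d} → Mat a b → Mat b d → Mat a d
    (A ⊙ B) i j = ∑[ k < _ ] (A i k * B k j)

    ⊙-entry : ∀ {a b d} (A : Mat a b) (B : Mat b d) i j → (A ⊙ B) i j ≡ ∑[ k < b ] (A i k * B k j)
    ⊙-entry A B i j = ≡.refl

  ≈ᴹ-setoid : ℕ → ℕ → Setoid c ℓ
  ≈ᴹ-setoid a b = record
    { Carrier       = Mat a b
    ; _≈_           = _≈ᴹ_
    ; isEquivalence = record
      { refl  = λ i j → refl
      ; sym   = λ A≈B i j → sym (A≈B i j)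
      ; trans = λ A≈B B≈C i j → trans (A≈B i j) (B≈C i j)
      }
    }

  module ≈ᴹ-Reasoning {a b} = Relation.Binary.Reasoning.Setoid (≈ᴹ-setoid a b)

  module _ {a b : ℕ} where
    open Setoid (≈ᴹ-setoid a b) public
      using () renaming (refl to ≈ᴹ-refl; sym to ≈ᴹ-sym; trans to ≈ᴹ-trans)

  ⊙≈· : ∀ {a b d} (A : Mat a b) (B : Mat b d) → A ⊙ B ≈ᴹ (A · B)
  ⊙≈· A B i j = reflexive (≡.trans (⊙-entry A B i j) (≡.sym (∑≡sum (λ k → A i k * B k j))))

  ⊙-entry-cong : ∀ {a b d a′ d′} {A : Mat a b} {B : Mat b d} {A′ : Mat a′ b} {B′ : Mat b d′} {i j i′ j′} →
                 (∀ k → A i k ≈ A′ i′ k) → (∀ k → B k j ≈ B′ k j′) → (A ⊙ B) i j ≈ (A′ ⊙ B′) i′ j′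
  ⊙-entry-cong {A = A} {B} {A′} {B′} {i} {j} {i′} {j′} Aᵢ≈A′ᵢ′ Bⱼ≈B′ⱼ′ = begin
    (A ⊙ B) i j                  ≡⟨ ⊙-entry A B i j ⟩
    ∑[ k < _ ] (A i k * B k j)     ≈⟨ sum-cong-≋ (λ k → *-cong (Aᵢ≈A′ᵢ′ k) (Bⱼ≈B′ⱼ′ k)) ⟩
    ∑[ k < _ ] (A′ i′ k * B′ k j′) ≡⟨ ⊙-entry A′ B′ i′ j′ ⟨
    (A′ ⊙ B′) i′ j′              ∎
    where open ≈-Reasoning

  ⊙-cong : ∀ {a b d} {A A′ : Mat a b} {B B′ : Mat b d} → A ≈ᴹ A′ → B ≈ᴹ B′ → A ⊙ B ≈ᴹ A′ ⊙ B′
  ⊙-cong A≈A′ B≈B′ i j = ⊙-entry-cong (A≈A′ i) (λ k → B≈B′ k j)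

  ⊙-congˡ : ∀ {a b d} {A : Mat a b} {B B′ : Mat b d} → B ≈ᴹ B′ → A ⊙ B ≈ᴹ A ⊙ B′
  ⊙-congˡ = ⊙-cong ≈ᴹ-refl

  ⊙-congʳ : ∀ {a b d} {A A′ : Mat a b} {B : Mat b d} → A ≈ᴹ A′ → A ⊙ B ≈ᴹ A′ ⊙ B
  ⊙-congʳ A≈A′ = ⊙-cong A≈A′ ≈ᴹ-refl

  ⊙≈·₃ : ∀ {a b d e} (A : Mat a b) (B : Mat b d) (C : Mat d e) → A ⊙ B ⊙ C ≈ᴹ ((A · B) · C)
  ⊙≈·₃ A B C = ≈ᴹ-trans (⊙-congʳ (⊙≈· A B)) (⊙≈· (A · B) C)

  ⊙-assoc : ∀ {a b d e} (A : Mat a b) (B : Mat b d) (C : Mat d e) → (A ⊙ B) ⊙ C ≈ᴹ A ⊙ (B ⊙ C)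
  ⊙-assoc {b = b} {d} A B C i j = begin
    ((A ⊙ B) ⊙ C) i j                            ≡⟨ ⊙-entry (A ⊙ B) C i j ⟩
    ∑[ k < d ] ((A ⊙ B) i k * C k j)               ≡⟨ sum-cong-≗ {d} (λ k → ≡.cong (_* C k j) (⊙-entry A B i k)) ⟩
    ∑[ k < d ] (∑[ l < b ] (A i l * B l k) * C k j) ≈⟨ sum-cong-≋ {d} (λ k → *-distribʳ-sum {b} (C k j) _) ⟩
    ∑[ k < d ] ∑[ l < b ] ((A i l * B l k) * C k j) ≈⟨ ∑-comm {d} {b} _ ⟩
    ∑[ l < b ] ∑[ k < d ] ((A i l * B l k) * C k j) ≈⟨ sum-cong-≋ {b} (λ l → sum-cong-≋ {d} (λ k → *-assoc _ _ _)) ⟩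
    ∑[ l < b ] ∑[ k < d ] (A i l * (B l k * C k j)) ≈⟨ sum-cong-≋ {b} (λ l → *-distribˡ-sum {d} (A i l) _) ⟨
    ∑[ l < b ] (A i l * ∑[ k < d ] (B l k * C k j)) ≡⟨ sum-cong-≗ {b} (λ l → ≡.cong (A i l *_) (⊙-entry B C l j)) ⟨
    ∑[ l < b ] (A i l * (B ⊙ C) l j)               ≡⟨ ⊙-entry A (B ⊙ C) i j ⟨
    (A ⊙ (B ⊙ C)) i j                            ∎
    where open ≈-Reasoning

  ⊙-identityˡ : ∀ {a b} (A : Mat a b) → I ⊙ A ≈ᴹ A
  ⊙-identityˡ A i j = trans (reflexive (⊙-entry I A i j)) (∑-δˡ i (λ k → A k j))

  ⊙-identityʳ : ∀ {a b} (A : Mat a b) → A ⊙ I ≈ᴹ A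
  ⊙-identityʳ A i j = trans (reflexive (⊙-entry A I i j)) (∑-δʳ j (A i))

  diag : ∀ {a} → (Fin a → Carrier) → Mat a a
  diag v i j = δ i j * v j

  ⊙-diag : ∀ {a b} (A : Mat a b) (v : Fin b → Carrier) i j → (A ⊙ diag v) i j ≈ A i j * v j
  ⊙-diag {b = b} A v i j = begin
    (A ⊙ diag v) i j                ≡⟨ ⊙-entry A (diag v) i j ⟩
    ∑[ k < b ] (A i k * (δ k j * v j)) ≈⟨ sum-cong-≋ {b} (λ k → *-assoc _ _ _) ⟨
    ∑[ k < b ] ((A i k * δ k j) * v j) ≈⟨ *-distribʳ-sum {b} (v j) _ ⟨
    ∑[ k < b ] (A i k * δ k j) * v j   ≈⟨ *-congʳ (∑-δʳ j (A i)) ⟩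
    A i j * v j                     ∎
    where open ≈-Reasoning

  diag-⊙ : ∀ {a b} (v : Fin a → Carrier) (A : Mat a b) i j → (diag v ⊙ A) i j ≈ v i * A i j
  diag-⊙ {a} v A i j = begin
    (diag v ⊙ A) i j                ≡⟨ ⊙-entry (diag v) A i j ⟩
    ∑[ k < a ] ((δ i k * v k) * A k j) ≈⟨ sum-cong-≋ {a} (λ k → *-assoc _ _ _) ⟩
    ∑[ k < a ] (δ i k * (v k * A k j)) ≈⟨ ∑-δˡ i (λ k → v k * A k j) ⟩
    v i * A i j                     ∎
    where open ≈-Reasoning

  Diagonal⇒≈diag : ∀ {a} {D : Mat a a} → Diagonal D → D ≈ᴹ diag (λ i → D i i)
  Diagonal⇒≈diag {D = D} D-diag i j with i Fin.≟ j
  ... | yes ≡.refl = sym (trans (*-congʳ (δ-diag i)) (*-identityˡ _))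
  ... | no i≢j     = trans (D-diag i j i≢j) (sym (trans (*-congʳ (δ-off i≢j)) (zeroˡ _)))

  diag-⊙-diag : ∀ {a} (u v : Fin a → Carrier) → diag u ⊙ diag v ≈ᴹ diag (λ i → u i * v i)
  diag-⊙-diag u v i j = trans (⊙-diag (diag u) v i j) (*-assoc (δ i j) (u j) (v j))

  infixr 35 _⋆_
  _⋆_ : ∀ {a b} → Carrier → Mat a b → Mat a b
  (x ⋆ A) i j = x * A i j

  ⋆-⊙ : ∀ {a b d} x (A : Mat a b) (B : Mat b d) → (x ⋆ A) ⊙ B ≈ᴹ x ⋆ (A ⊙ B)
  ⋆-⊙ {b = b} x A B i j = begin
    ((x ⋆ A) ⊙ B) i j              ≡⟨ ⊙-entry (x ⋆ A) B i j ⟩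
    ∑[ k < b ] ((x * A i k) * B k j) ≈⟨ sum-cong-≋ {b} (λ k → *-assoc x (A i k) (B k j)) ⟩
    ∑[ k < b ] (x * (A i k * B k j)) ≈⟨ *-distribˡ-sum {b} x _ ⟨
    x * ∑[ k < b ] (A i k * B k j)   ≡⟨ ≡.cong (x *_) (⊙-entry A B i j) ⟨
    (x ⋆ (A ⊙ B)) i j              ∎
    where open ≈-Reasoning

  ⊙-⋆ : ∀ {a b d} x (A : Mat a b) (B : Mat b d) → A ⊙ (x ⋆ B) ≈ᴹ x ⋆ (A ⊙ B)
  ⊙-⋆ {b = b} x A B i j = begin
    (A ⊙ (x ⋆ B)) i j              ≡⟨ ⊙-entry A (x ⋆ B) i j ⟩
    ∑[ k < b ] (A i k * (x * B k j)) ≈⟨ sum-cong-≋ {b} (λ k → x∙yz≈y∙xz (A i k) x (B k j)) ⟩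
    ∑[ k < b ] (x * (A i k * B k j)) ≈⟨ *-distribˡ-sum {b} x _ ⟨
    x * ∑[ k < b ] (A i k * B k j)   ≡⟨ ≡.cong (x *_) (⊙-entry A B i j) ⟨
    (x ⋆ (A ⊙ B)) i j              ∎
    where open ≈-Reasoning

  ⊙-cancelˡ : ∀ {a b d} {A : Mat a b} {B : Mat b a} → A ⊙ B ≈ᴹ I → (C : Mat a d) → A ⊙ (B ⊙ C) ≈ᴹ C
  ⊙-cancelˡ {A = A} {B} A⊙B≈I C = ≈ᴹ-trans (≈ᴹ-sym (⊙-assoc A B C)) (≈ᴹ-trans (⊙-congʳ A⊙B≈I) (⊙-identityˡ C))

  ⊙-cancelʳ : ∀ {a b d} {A : Mat a b} {B : Mat b a} → A ⊙ B ≈ᴹ I → (C : Mat d a) → (C ⊙ A) ⊙ B ≈ᴹ C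
  ⊙-cancelʳ {A = A} {B} A⊙B≈I C = ≈ᴹ-trans (⊙-assoc C A B) (≈ᴹ-trans (⊙-congˡ A⊙B≈I) (⊙-identityʳ C))

  diag-cong : ∀ {a} {u v : Fin a → Carrier} → (∀ i → u i ≈ v i) → diag u ≈ᴹ diag v
  diag-cong u≈v i j = *-congˡ (u≈v j)

  diag-comm : ∀ {a} (u v : Fin a → Carrier) → diag u ⊙ diag v ≈ᴹ diag v ⊙ diag u
  diag-comm u v = ≈ᴹ-trans (diag-⊙-diag u v) (≈ᴹ-trans (diag-cong (λ i → *-comm (u i) (v i))) (≈ᴹ-sym (diag-⊙-diag v u)))

  diag-scale : ∀ {a} x (v : Fin a → Carrier) → diag (λ i → x * v i) ≈ᴹ x ⋆ diag v
  diag-scale x v i j = x∙yz≈y∙xz (δ i j) x (v j)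

  ⋆≈⊙diag : ∀ {a b} x (A : Mat a b) → x ⋆ A ≈ᴹ A ⊙ diag (λ _ → x)
  ⋆≈⊙diag x A i j = trans (*-comm x (A i j)) (sym (⊙-diag A _ i j))

  ⋆≈diag⊙ : ∀ {a b} x (A : Mat a b) → x ⋆ A ≈ᴹ diag (λ _ → x) ⊙ A
  ⋆≈diag⊙ x A i j = sym (diag-⊙ _ A i j)

  columns : ∀ {a t u} → (Fin t → Mat a u) → Mat a (t ℕ.* u)
  columns {u = u} M i x = uncurry (λ b l → M b i l) (Fin.remQuot u x)

  rows : ∀ {a t u} → (Fin t → Mat u a) → Mat (t ℕ.* u) a
  rows {u = u} M x j = uncurry (λ b l → M b l j) (Fin.remQuot u x)

  blockwise : ∀ {t u} → (Fin t → Fin u → Carrier) → Fin (t ℕ.* u) → Carrier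
  blockwise {u = u} μ x = uncurry μ (Fin.remQuot u x)

  columns-⊙-rows : ∀ {a d t u} (M : Fin t → Mat a u) (N : Fin t → Mat u d) i j →
                   (columns M ⊙ rows N) i j ≈ ∑[ b < t ] (M b ⊙ N b) i j
  columns-⊙-rows {t = t} {u} M N i j = begin
    (columns M ⊙ rows N) i j                                        ≡⟨ ⊙-entry (columns M) (rows N) i j ⟩
    ∑[ x < t ℕ.* u ] (columns M i x * rows N x j)                    ≈⟨ ∑-combine t _ ⟩
    ∑[ b < t ] ∑[ l < u ] (columns M i (Fin.combine b l) * rows N (Fin.combine b l) j)
      ≡⟨ sum-cong-≗ {t} (λ b → sum-cong-≗ {u} (λ l → ≡.cong (uncurry λ b l → M b i l * N b l j) (Fin.remQuot-combine b l))) ⟩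
    ∑[ b < t ] ∑[ l < u ] (M b i l * N b l j)                          ≡⟨ sum-cong-≗ {t} (λ b → ⊙-entry (M b) (N b) i j) ⟨
    ∑[ b < t ] (M b ⊙ N b) i j                                      ∎
    where open ≈-Reasoning

  columns-eigen : ∀ {a t u} (A : Mat a a) (M : Fin t → Mat a u) (μ : Fin t → Fin u → Carrier) →
                  (∀ b → A ⊙ M b ≈ᴹ M b ⊙ diag (μ b)) → A ⊙ columns M ≈ᴹ columns M ⊙ diag (blockwise μ)
  columns-eigen {t = t} {u} A M μ eigen i x =
    trans (⊙-entry-cong (λ _ → refl) (λ _ → refl))
      (trans (eigen b i l) (trans (⊙-diag (M b) (μ b) i l) (sym (⊙-diag (columns M) (blockwise μ) i x))))
    where
    b = proj₁ (Fin.remQuot {t} u x)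
    l = proj₂ (Fin.remQuot {t} u x)

  rows-eigen : ∀ {a t u} (A : Mat a a) (N : Fin t → Mat u a) (μ : Fin t → Fin u → Carrier) →
               (∀ b → N b ⊙ A ≈ᴹ diag (μ b) ⊙ N b) → rows N ⊙ A ≈ᴹ diag (blockwise μ) ⊙ rows N
  rows-eigen {t = t} {u} A N μ eigen x j =
    trans (⊙-entry-cong (λ _ → refl) (λ _ → refl))
      (trans (eigen b l j) (trans (diag-⊙ (μ b) (N b) l j) (sym (diag-⊙ (blockwise μ) (rows N) x j))))
    where
    b = proj₁ (Fin.remQuot {t} u x)
    l = proj₂ (Fin.remQuot {t} u x)



  rowOp : ∀ {a b} → (Fin a → Carrier) → Fin a → Mat a b → Mat a b
  rowOp s i A r j = A r j - s r * A i j

  rowOp-⊙ : ∀ {a b d} (s : Fin a → Carrier) i (A : Mat a b) (B : Mat b d) → rowOp s i A ⊙ B ≈ᴹ rowOp s i (A ⊙ B)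
  rowOp-⊙ {b = b} s i A B r j = begin
    (rowOp s i A ⊙ B) r j                                    ≡⟨ ⊙-entry (rowOp s i A) B r j ⟩
    ∑[ k < b ] ((A r k - s r * A i k) * B k j)
      ≈⟨ sum-cong-≋ {b} (λ k → trans ([y-z]x≈yx-zx (B k j) _ _) (+-congˡ (-‿cong (*-assoc _ _ _)))) ⟩
    ∑[ k < b ] (A r k * B k j - s r * (A i k * B k j))         ≈⟨ ∑-sub b _ _ ⟩
    ∑[ k < b ] (A r k * B k j) - ∑[ k < b ] (s r * (A i k * B k j)) ≈⟨ +-congˡ (-‿cong (*-distribˡ-sum {b} (s r) _)) ⟨
    ∑[ k < b ] (A r k * B k j) - s r * ∑[ k < b ] (A i k * B k j)   ≡⟨ ≡.cong₂ (λ x y → x - s r * y) (⊙-entry A B r j) (⊙-entry A B i j) ⟨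
    rowOp s i (A ⊙ B) r j                                    ∎
    where open ≈-Reasoning

  ⊙-rowOp : ∀ {a b d} (A : Mat a b) (s : Fin b → Carrier) i (B : Mat b d) r j →
            (A ⊙ rowOp s i B) r j ≈ (A ⊙ B) r j - B i j * ∑[ k < b ] (A r k * s k)
  ⊙-rowOp {b = b} A s i B r j = begin
    (A ⊙ rowOp s i B) r j                                    ≡⟨ ⊙-entry A (rowOp s i B) r j ⟩
    ∑[ k < b ] (A r k * (B k j - s k * B i j))
      ≈⟨ sum-cong-≋ {b} (λ k → trans (x[y-z]≈xy-xz (A r k) _ _) (+-congˡ (-‿cong (x∙yz≈z∙xy _ _ _)))) ⟩
    ∑[ k < b ] (A r k * B k j - B i j * (A r k * s k))         ≈⟨ ∑-sub b _ _ ⟩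
    ∑[ k < b ] (A r k * B k j) - ∑[ k < b ] (B i j * (A r k * s k)) ≈⟨ +-congˡ (-‿cong (*-distribˡ-sum {b} (B i j) _)) ⟨
    ∑[ k < b ] (A r k * B k j) - B i j * ∑[ k < b ] (A r k * s k)   ≡⟨ ≡.cong (_- B i j * _) (⊙-entry A B r j) ⟨
    (A ⊙ B) r j - B i j * ∑[ k < b ] (A r k * s k)           ∎
    where open ≈-Reasoning

  ⊙-removeAt : ∀ {a b d} (A : Mat a (suc b)) (B : Mat (suc b) d) i → (∀ j → B i j ≈ 0#) →
               (λ r k → A r (punchIn i k)) ⊙ (λ k j → B (punchIn i k) j) ≈ᴹ A ⊙ B
  ⊙-removeAt {b = b} A B i Bᵢ≈0 r j = begin
    ((λ r k → A r (punchIn i k)) ⊙ (λ k j → B (punchIn i k) j)) r j ≡⟨ ⊙-entry _ _ r j ⟩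
    ∑[ k < b ] (A r (punchIn i k) * B (punchIn i k) j)             ≈⟨ +-identityˡ _ ⟨
    0# + ∑[ k < b ] (A r (punchIn i k) * B (punchIn i k) j)        ≈⟨ +-congʳ (trans (*-congˡ (Bᵢ≈0 j)) (zeroʳ _)) ⟨
    A r i * B i j + ∑[ k < b ] (A r (punchIn i k) * B (punchIn i k) j) ≈⟨ sum-remove {i = i} (λ k → A r k * B k j) ⟨
    ∑[ k < suc b ] (A r k * B k j)                                ≡⟨ ⊙-entry A B r j ⟨
    (A ⊙ B) r j                                                  ∎
    where open ≈-Reasoning

  ⊙-diag-commute : ∀ {a} {M : Mat a a} {v : Fin a → Carrier} → M ⊙ diag v ≈ᴹ diag v ⊙ M →
                   ∀ i j → M i j * v j ≈ v i * M i j
  ⊙-diag-commute {M = M} {v} M⇄v i j = trans (sym (⊙-diag M v i j)) (trans (M⇄v i j) (diag-⊙ v M i j))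

  -- Tensor decompositions and the substitution method

  record Decomposition (a b e t : ℕ) : Set c where
    field
      u : Fin t → Fin a → Carrier
      v : Fin t → Fin b → Carrier
      w : Fin t → Fin e → Carrier

  ⟦_⟧ : ∀ {a b e t} → Decomposition a b e t → Tensor a b e
  ⟦_⟧ {t = t} D i j k = ∑[ l < t ] ((u l i * v l j) * w l k)
    where open Decomposition D

  reindex : ∀ {a b e a′ b′ e′ t} → (Fin a′ → Fin a) → (Fin b′ → Fin b) → (Fin e′ → Fin e) →
            Decomposition a b e t → Decomposition a′ b′ e′ t
  reindex f g h D = record { u = λ l → u l ∘ f ; v = λ l → v l ∘ g ; w = λ l → w l ∘ h }
    where open Decomposition D

  transpose : ∀ {a b e t} → Decomposition a b e t → Decomposition b a e t
  transpose D = record { u = v ; v = u ; w = w }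
    where open Decomposition D

  ⟦transpose⟧ : ∀ {a b e t} (D : Decomposition a b e t) i j k → ⟦ transpose D ⟧ j i k ≈ ⟦ D ⟧ i j k
  ⟦transpose⟧ {t = t} D i j k = sum-cong-≋ {t} (λ l → *-congʳ (*-comm (v l j) (u l i)))
    where open Decomposition D

  Decomposition⇒HasDecomposition : ∀ {a b e t} {S : Tensor a b e} (D : Decomposition a b e t) →
                                    (∀ i j k → S i j k ≈ ⟦ D ⟧ i j k) → HasDecomposition S t
  Decomposition⇒HasDecomposition D S≈D =
    u , v , w , λ i j k → trans (S≈D i j k) (reflexive (≡.sym (∑≡sum (λ l → (u l i * v l j) * w l k))))
    where open Decomposition D

  zero-row⇒⟦⟧≈0 : ∀ {a b e t} (D : Decomposition a b e t) {i j k} → (∀ l → Decomposition.u D l i ≈ 0#) → ⟦ D ⟧ i j k ≈ 0#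
  zero-row⇒⟦⟧≈0 D uᵢ≈0 = ∑-zero (λ l → trans (*-congʳ (trans (*-congʳ (uᵢ≈0 l)) (zeroˡ _))) (zeroˡ _))

  module RowReduction {a b e t} (D : Decomposition (suc a) b e (suc t))
                      (l₀ : Fin (suc t)) (pivot≉0 : ¬ Decomposition.u D l₀ zero ≈ 0#) where
    open Decomposition D

    multiplier : Fin a → Carrier
    multiplier i = u l₀ (suc i) * proj₁ (inverse (u l₀ zero) pivot≉0)

    reduct : Decomposition a b e t
    reduct = record
      { u = λ l i → u (punchIn l₀ l) (suc i) - multiplier i * u (punchIn l₀ l) zero
      ; v = v ∘ punchIn l₀
      ; w = w ∘ punchIn l₀
      }

    ⟦reduct⟧ : ∀ i j k → ⟦ reduct ⟧ i j k ≈ ⟦ D ⟧ (suc i) j k - multiplier i * ⟦ D ⟧ zero j k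
    ⟦reduct⟧ i j k = sym (begin
      ⟦ D ⟧ (suc i) j k - g * ⟦ D ⟧ zero j k                       ≈⟨ +-congˡ (-‿cong (*-distribˡ-sum {suc t} g term₀)) ⟩
      ∑[ l < suc t ] term₊ l - ∑[ l < suc t ] (g * term₀ l)      ≈⟨ ∑-sub (suc t) term₊ (λ l → g * term₀ l) ⟨
      ∑[ l < suc t ] (term₊ l - g * term₀ l)                     ≈⟨ sum-cong-≋ {suc t} (λ l → sym (reducedTerm≈ l)) ⟩
      ∑[ l < suc t ] reducedTerm l                               ≈⟨ sum-remove {i = l₀} reducedTerm ⟩
      reducedTerm l₀ + ∑[ l < t ] reducedTerm (punchIn l₀ l)     ≈⟨ +-congʳ pivotTerm≈0 ⟩
      0# + ∑[ l < t ] reducedTerm (punchIn l₀ l)                 ≈⟨ +-identityˡ _ ⟩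
      ⟦ reduct ⟧ i j k                                           ∎)
      where
      open ≈-Reasoning
      g = multiplier i
      term₊ term₀ reducedTerm : Fin (suc t) → Carrier
      term₊ l = (u l (suc i) * v l j) * w l k
      term₀ l = (u l zero * v l j) * w l k
      reducedTerm l = ((u l (suc i) - g * u l zero) * v l j) * w l k
      reducedTerm≈ : ∀ l → reducedTerm l ≈ term₊ l - g * term₀ l
      reducedTerm≈ l = begin
        ((u l (suc i) - g * u l zero) * v l j) * w l k                  ≈⟨ *-congʳ ([y-z]x≈yx-zx (v l j) _ _) ⟩
        (u l (suc i) * v l j - (g * u l zero) * v l j) * w l k          ≈⟨ [y-z]x≈yx-zx (w l k) _ _ ⟩
        term₊ l - ((g * u l zero) * v l j) * w l k                      ≈⟨ +-congˡ (-‿cong (trans (*-congʳ (*-assoc _ _ _)) (*-assoc _ _ _))) ⟩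
        term₊ l - g * term₀ l                                          ∎
      pivotEntry≈0 : u l₀ (suc i) - g * u l₀ zero ≈ 0#
      pivotEntry≈0 = begin
        u l₀ (suc i) - (u l₀ (suc i) * p⁻¹) * u l₀ zero
          ≈⟨ +-congˡ (-‿cong (trans (*-assoc _ _ _) (*-congˡ (trans (*-comm _ _) (proj₂ (inverse _ pivot≉0)))))) ⟩
        u l₀ (suc i) - u l₀ (suc i) * 1#               ≈⟨ +-congˡ (-‿cong (*-identityʳ _)) ⟩
        u l₀ (suc i) - u l₀ (suc i)                    ≈⟨ -‿inverseʳ _ ⟩
        0#                                             ∎
        where p⁻¹ = proj₁ (inverse (u l₀ zero) pivot≉0)
      pivotTerm≈0 : reducedTerm l₀ ≈ 0#
      pivotTerm≈0 = trans (*-congʳ (trans (*-congʳ pivotEntry≈0) (zeroˡ _))) (zeroˡ _)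

  IsRowReduct : ∀ {a b e t t′} → Decomposition (suc a) b e t → Decomposition a b e t′ → Set (c ⊔ ℓ)
  IsRowReduct {a} D D′ = Σ (Fin a → Carrier) λ g → ∀ i j k → ⟦ D′ ⟧ i j k ≈ ⟦ D ⟧ (suc i) j k - g i * ⟦ D ⟧ zero j k

  eliminate-row : ∀ {a b e t} (D : Decomposition (suc a) b e t) {j k} → ¬ ⟦ D ⟧ zero j k ≈ 0# →
                  DoubleNegation (Σ ℕ λ t′ → suc t′ ≡ t × Σ (Decomposition a b e t′) (IsRowReduct D))
  eliminate-row D ⟦D⟧≉0 = do
      l₀ , pivot≉0 ← ¬∀⇒¬¬∃¬ (⟦D⟧≉0 ∘ zero-row⇒⟦⟧≈0 D)
      return (reduce D l₀ pivot≉0)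
    where
    reduce : ∀ {a b e t} (D : Decomposition (suc a) b e t) (l₀ : Fin t) → ¬ Decomposition.u D l₀ zero ≈ 0# →
             Σ ℕ λ t′ → suc t′ ≡ t × Σ (Decomposition a b e t′) (IsRowReduct D)
    reduce {t = suc t} D l₀ pivot≉0 = t , ≡.refl , reduct , multiplier , ⟦reduct⟧
      where open RowReduction D l₀ pivot≉0

  eliminate-unit-rows :
    ∀ ρ {a b e t} (D : Decomposition (ρ ℕ.+ a) b e t) (j₀ : Fin ρ → Fin b) (k₀ : Fin ρ → Fin e) →
    (∀ x y → ⟦ D ⟧ (x ↑ˡ a) (j₀ y) (k₀ y) ≈ δ x y) →
    DoubleNegation (Σ ℕ λ t′ → ρ ℕ.+ t′ ℕ.≤ t × Σ (Decomposition a b e t′) λ D′ →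
      ∀ i j k → (∀ x → ⟦ D ⟧ (x ↑ˡ a) j k ≈ 0#) → ⟦ D′ ⟧ i j k ≈ ⟦ D ⟧ (ρ ↑ʳ i) j k)
  eliminate-unit-rows zero {t = t} D j₀ k₀ unit = return (t , ℕ.≤-refl , D , λ i j k _ → refl)
  eliminate-unit-rows (suc ρ) {a} D j₀ k₀ unit = do
      t₁ , ≡.refl , D₁ , D₁-reduct ← eliminate-row D (λ ⟦D⟧≈0 → 0≉1 (trans (sym ⟦D⟧≈0) (unit zero zero)))
      let open Reduct D₁ D₁-reduct
      t′ , ρ+t′≤t₁ , D′ , D′≈ ← eliminate-unit-rows ρ D₁ (j₀ ∘ suc) (k₀ ∘ suc) unit₁
      return (t′ , ℕ.s≤s ρ+t′≤t₁ , D′ , λ i j k vanish → trans (D′≈ i j k (vanish₁ vanish)) (kept vanish i))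
    where
    module Reduct {t₁} (D₁ : Decomposition (ρ ℕ.+ a) _ _ t₁) (D₁-reduct : IsRowReduct D D₁) where
      open Σ D₁-reduct renaming (proj₁ to g; proj₂ to D₁≈)

      unit₁ : ∀ x y → ⟦ D₁ ⟧ (x ↑ˡ a) (j₀ (suc y)) (k₀ (suc y)) ≈ δ x y
      unit₁ x y = trans (D₁≈ _ _ _) (trans (+-congʳ (unit (suc x) (suc y))) (x-y*z≈x _ (g _) (unit zero (suc y))))

      module _ {j k} (vanish : ∀ x → ⟦ D ⟧ (x ↑ˡ a) j k ≈ 0#) where
        vanish₁ : ∀ x → ⟦ D₁ ⟧ (x ↑ˡ a) j k ≈ 0#
        vanish₁ x = trans (D₁≈ _ j k) (trans (+-congʳ (vanish (suc x))) (x-y*z≈x 0# (g _) (vanish zero)))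

        kept : ∀ i → ⟦ D₁ ⟧ (ρ ↑ʳ i) j k ≈ ⟦ D ⟧ (suc ρ ↑ʳ i) j k
        kept i = trans (D₁≈ _ j k) (x-y*z≈x _ (g _) (vanish zero))

  -- U and V give a decomposition of length q of the t × t identity, whose t rows are unit rows.
  hasRightInverse⇒≤ : ∀ {t q} (U : Mat t q) (V : Mat q t) → U ⊙ V ≈ᴹ I → t ℕ.≤ q
  hasRightInverse⇒≤ {t} {q} U V U⊙V≈I = decidable-stable (t ℕ.≤? q) (do
      t′ , t+t′≤q , _ ← eliminate-unit-rows t D id (λ _ → zero) unit
      return (ℕ.≤-trans (ℕ.m≤m+n t t′) t+t′≤q))
    where
    row : Fin (t ℕ.+ 0) → Fin t
    row i = [ id , (λ ()) ]′ (Fin.splitAt t i)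

    D : Decomposition (t ℕ.+ 0) t 1 q
    D = record { u = λ l i → U (row i) l ; v = λ l j → V l j ; w = λ _ _ → 1# }

    unit : ∀ x y → ⟦ D ⟧ (x ↑ˡ 0) y zero ≈ δ x y
    unit x y = begin
      ∑[ l < q ] ((U (row (x ↑ˡ 0)) l * V l y) * 1#) ≡⟨ ≡.cong (λ i → ∑[ l < q ] ((U i l * V l y) * 1#)) row-↑ˡ ⟩
      ∑[ l < q ] ((U x l * V l y) * 1#)             ≈⟨ sum-cong-≋ {q} (λ l → *-identityʳ _) ⟩
      ∑[ l < q ] (U x l * V l y)                    ≡⟨ ⊙-entry U V x y ⟨
      (U ⊙ V) x y                                 ≈⟨ U⊙V≈I x y ⟩
      δ x y                                       ∎
      where
      open ≈-Reasoning
      row-↑ˡ : row (x ↑ˡ 0) ≡ x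
      row-↑ˡ = ≡.cong [ id , (λ ()) ]′ (Fin.splitAt-↑ˡ t x 0)

  -- Eigenframes and simultaneous diagonalization

  -- The columns of X are common eigenvectors of the family Z spanning K^q (X ⊙ Y ≈ I), and
  -- the rows of Y are matching left eigenvectors; if moreover t = q and Y ⊙ X ≈ I, then
  -- X⁻¹ Z k X is diagonal for every k.
  record EigenFrame {q p} (Z : Fin p → Mat q q) (t : ℕ) : Set (c ⊔ ℓ) where
    field
      X : Mat q t
      Y : Mat t q
      eigenvalue : Fin t → Fin p → Carrier
      X⊙Y≈I : X ⊙ Y ≈ᴹ I
      Z⊙X≈X⊙Λ : ∀ k → Z k ⊙ X ≈ᴹ X ⊙ diag (λ b → eigenvalue b k)
      Y⊙Z≈Λ⊙Y : ∀ k → Y ⊙ Z k ≈ᴹ diag (λ b → eigenvalue b k) ⊙ Y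

  TwoSidedFrame : ∀ {q p} → (Fin p → Mat q q) → ℕ → Set (c ⊔ ℓ)
  TwoSidedFrame Z t = Σ (EigenFrame Z t) λ E → EigenFrame.Y E ⊙ EigenFrame.X E ≈ᴹ I

  Diagonalization : ∀ {q p} → (Fin p → Mat q q) → Set (c ⊔ ℓ)
  Diagonalization {q} Z = TwoSidedFrame Z q

  diagonalizable⇒diagonalization : ∀ {q} {Z : Mat q q} → Diagonalizable Z → Diagonalization (λ (_ : Fin 1) → Z)
  diagonalizable⇒diagonalization {q} {Z} (P , Q , D , P·Q≈I , Q·P≈I , D-diag , Z≈PDQ) = frame , Q⊙P≈I
    where
    P⊙Q≈I : P ⊙ Q ≈ᴹ I
    P⊙Q≈I = ≈ᴹ-trans (⊙≈· P Q) P·Q≈I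
    Q⊙P≈I : Q ⊙ P ≈ᴹ I
    Q⊙P≈I = ≈ᴹ-trans (⊙≈· Q P) Q·P≈I
    Z≈P⊙D⊙Q : Z ≈ᴹ P ⊙ D ⊙ Q
    Z≈P⊙D⊙Q = ≈ᴹ-trans Z≈PDQ (≈ᴹ-sym (⊙≈·₃ P D Q))
    Λ = diag (λ b → D b b)
    frame : EigenFrame (λ _ → Z) q
    frame = record
      { X = P ; Y = Q ; eigenvalue = λ b _ → D b b ; X⊙Y≈I = P⊙Q≈I
      ; Z⊙X≈X⊙Λ = λ _ → begin
          Z ⊙ P               ≈⟨ ⊙-congʳ Z≈P⊙D⊙Q ⟩
          P ⊙ D ⊙ Q ⊙ P       ≈⟨ ⊙-cancelʳ Q⊙P≈I (P ⊙ D) ⟩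
          P ⊙ D               ≈⟨ ⊙-congˡ (Diagonal⇒≈diag D-diag) ⟩
          P ⊙ Λ               ∎
      ; Y⊙Z≈Λ⊙Y = λ _ → begin
          Q ⊙ Z               ≈⟨ ⊙-congˡ Z≈P⊙D⊙Q ⟩
          Q ⊙ (P ⊙ D ⊙ Q)     ≈⟨ ⊙-congˡ (⊙-assoc P D Q) ⟩
          Q ⊙ (P ⊙ (D ⊙ Q))   ≈⟨ ⊙-cancelˡ Q⊙P≈I (D ⊙ Q) ⟩
          D ⊙ Q               ≈⟨ ⊙-congʳ (Diagonal⇒≈diag D-diag) ⟩
          Λ ⊙ Q               ∎
      }
      where open ≈ᴹ-Reasoning

  -- α is a linear relation among the columns of X within one joint eigenspace (α-eigen), so
  -- column i is redundant once multiples of row i of Y are added to the other rows.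
  module DropColumn {q p t} {Z : Fin p → Mat q q} (E : EigenFrame Z (suc t)) (i : Fin (suc t))
                    (α : Fin (suc t) → Carrier)
                    (X⊙α≈0 : ∀ r → ∑[ b < suc t ] (EigenFrame.X E r b * α b) ≈ 0#) (αᵢ≉0 : ¬ α i ≈ 0#)
                    (α-eigen : ∀ b k → α b * EigenFrame.eigenvalue E b k ≈ α b * EigenFrame.eigenvalue E i k) where
    open EigenFrame E

    αᵢ⁻¹ : Carrier
    αᵢ⁻¹ = proj₁ (inverse (α i) αᵢ≉0)

    s : Fin (suc t) → Carrier
    s b = α b * αᵢ⁻¹

    sᵢ≈1 : s i ≈ 1#
    sᵢ≈1 = proj₂ (inverse (α i) αᵢ≉0)

    s-eigen : ∀ b k → s b * eigenvalue i k ≈ s b * eigenvalue b k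
    s-eigen b k = trans (xy∙z≈xz∙y _ _ _) (trans (*-congʳ (sym (α-eigen b k))) (xy∙z≈xz∙y _ _ _))

    Y′ : Mat (suc t) q
    Y′ = rowOp s i Y

    Y′ᵢ≈0 : ∀ j → Y′ i j ≈ 0#
    Y′ᵢ≈0 j = trans (+-congˡ (-‿cong (trans (*-congʳ sᵢ≈1) (*-identityˡ _)))) (-‿inverseʳ _)

    X⊙Y′≈I : X ⊙ Y′ ≈ᴹ I
    X⊙Y′≈I r j = begin
      (X ⊙ Y′) r j                                    ≈⟨ ⊙-rowOp X s i Y r j ⟩
      (X ⊙ Y) r j - Y i j * ∑[ b < suc t ] (X r b * s b) ≈⟨ x-y*z≈x _ _ X⊙s≈0 ⟩
      (X ⊙ Y) r j                                    ≈⟨ X⊙Y≈I r j ⟩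
      δ r j                                          ∎
      where
      open ≈-Reasoning
      X⊙s≈0 : ∑[ b < suc t ] (X r b * s b) ≈ 0#
      X⊙s≈0 = begin
        ∑[ b < suc t ] (X r b * (α b * αᵢ⁻¹)) ≈⟨ sum-cong-≋ {suc t} (λ b → *-assoc (X r b) (α b) αᵢ⁻¹) ⟨
        ∑[ b < suc t ] ((X r b * α b) * αᵢ⁻¹) ≈⟨ *-distribʳ-sum {suc t} αᵢ⁻¹ (λ b → X r b * α b) ⟨
        ∑[ b < suc t ] (X r b * α b) * αᵢ⁻¹   ≈⟨ *-congʳ (X⊙α≈0 r) ⟩
        0# * αᵢ⁻¹                           ≈⟨ zeroˡ αᵢ⁻¹ ⟩
        0#                                  ∎

    Y′⊙Z≈Λ⊙Y′ : ∀ k → Y′ ⊙ Z k ≈ᴹ diag (λ b → eigenvalue b k) ⊙ Y′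
    Y′⊙Z≈Λ⊙Y′ k b j = begin
      (Y′ ⊙ Z k) b j                                  ≈⟨ rowOp-⊙ s i Y (Z k) b j ⟩
      (Y ⊙ Z k) b j - s b * (Y ⊙ Z k) i j             ≈⟨ +-cong (eigenrow b) (-‿cong (*-congˡ (eigenrow i))) ⟩
      μ b * Y b j - s b * (μ i * Y i j)                ≈⟨ +-congˡ (-‿cong (trans (sym (*-assoc _ _ _)) (*-congʳ (s-eigen b k)))) ⟩
      μ b * Y b j - (s b * μ b) * Y i j                ≈⟨ +-congˡ (-‿cong (xy∙z≈y∙xz _ _ _)) ⟩
      μ b * Y b j - μ b * (s b * Y i j)                ≈⟨ x[y-z]≈xy-xz (μ b) _ _ ⟨
      μ b * Y′ b j                                    ≈⟨ diag-⊙ μ Y′ b j ⟨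
      (diag μ ⊙ Y′) b j                               ∎
      where
      open ≈-Reasoning
      μ = λ b → eigenvalue b k
      eigenrow : ∀ b → (Y ⊙ Z k) b j ≈ μ b * Y b j
      eigenrow b = trans (Y⊙Z≈Λ⊙Y k b j) (diag-⊙ μ Y b j)

    frame : EigenFrame Z t
    frame = record
      { X = λ r b → X r (punchIn i b)
      ; Y = λ b j → Y′ (punchIn i b) j
      ; eigenvalue = eigenvalue ∘ punchIn i
      ; X⊙Y≈I = ≈ᴹ-trans (⊙-removeAt X Y′ i Y′ᵢ≈0) X⊙Y′≈I
      ; Z⊙X≈X⊙Λ = λ k r b → trans (⊙-entry-cong (λ _ → refl) (λ _ → refl))
                               (trans (Z⊙X≈X⊙Λ k r (punchIn i b)) (trans (⊙-diag X _ r (punchIn i b)) (sym (⊙-diag _ _ r b))))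
      ; Y⊙Z≈Λ⊙Y = λ k b j → trans (⊙-entry-cong (λ _ → refl) (λ _ → refl))
                               (trans (Y′⊙Z≈Λ⊙Y′ k (punchIn i b) j) (trans (diag-⊙ _ Y′ (punchIn i b) j) (sym (diag-⊙ _ _ b j))))
      }

  -- If Y ⊙ X ≉ I, column j of I - Y ⊙ X is such a relation: X (I - Y X) = 0, and Y X commutes
  -- with the diagonal eigenvalue matrices.
  module KernelVector {q p t} {Z : Fin p → Mat q q} (E : EigenFrame Z t) (i j : Fin t)
                      (Nᵢⱼ≉δᵢⱼ : ¬ (EigenFrame.Y E ⊙ EigenFrame.X E) i j ≈ δ i j) where
    open EigenFrame E

    N : Mat t t
    N = Y ⊙ X

    α : Fin t → Carrier
    α b = δ b j - N b j

    X⊙α≈0 : ∀ r → ∑[ b < t ] (X r b * α b) ≈ 0#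
    X⊙α≈0 r = begin
      ∑[ b < t ] (X r b * (δ b j - N b j))                ≈⟨ sum-cong-≋ {t} (λ b → x[y-z]≈xy-xz (X r b) _ _) ⟩
      ∑[ b < t ] (X r b * δ b j - X r b * N b j)          ≈⟨ ∑-sub t _ _ ⟩
      ∑[ b < t ] (X r b * δ b j) - ∑[ b < t ] (X r b * N b j) ≈⟨ +-cong (∑-δʳ j (X r)) (-‿cong (reflexive (≡.sym (⊙-entry X N r j)))) ⟩
      X r j - (X ⊙ (Y ⊙ X)) r j                         ≈⟨ +-congˡ (-‿cong (⊙-cancelˡ X⊙Y≈I X r j)) ⟩
      X r j - X r j                                     ≈⟨ -‿inverseʳ _ ⟩
      0#                                                ∎
      where open ≈-Reasoning

    αᵢ≉0 : ¬ α i ≈ 0#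
    αᵢ≉0 αᵢ≈0 = Nᵢⱼ≉δᵢⱼ (sym (x∙y⁻¹≈ε⇒x≈y _ _ αᵢ≈0))

    N⇄Λ : ∀ k → N ⊙ diag (λ b → eigenvalue b k) ≈ᴹ diag (λ b → eigenvalue b k) ⊙ N
    N⇄Λ k = begin
      Y ⊙ X ⊙ Λ       ≈⟨ ⊙-assoc Y X Λ ⟩
      Y ⊙ (X ⊙ Λ)     ≈⟨ ⊙-congˡ (Z⊙X≈X⊙Λ k) ⟨
      Y ⊙ (Z k ⊙ X)   ≈⟨ ⊙-assoc Y (Z k) X ⟨
      Y ⊙ Z k ⊙ X     ≈⟨ ⊙-congʳ (Y⊙Z≈Λ⊙Y k) ⟩
      Λ ⊙ Y ⊙ X       ≈⟨ ⊙-assoc Λ Y X ⟩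
      Λ ⊙ (Y ⊙ X)     ∎
      where
      open ≈ᴹ-Reasoning
      Λ = diag (λ b → eigenvalue b k)

    α-eigenʲ : ∀ b k → α b * eigenvalue b k ≈ α b * eigenvalue j k
    α-eigenʲ b k = begin
      α b * μ b                     ≈⟨ *-comm _ _ ⟩
      μ b * α b                     ≈⟨ x[y-z]≈xy-xz (μ b) _ _ ⟩
      μ b * δ b j - μ b * N b j     ≈⟨ +-cong (sym (⊙-diag-commute I⇄Λ b j)) (-‿cong (sym (⊙-diag-commute (N⇄Λ k) b j))) ⟩
      δ b j * μ j - N b j * μ j     ≈⟨ [y-z]x≈yx-zx (μ j) _ _ ⟨
      α b * μ j                     ∎
      where
      open ≈-Reasoning
      μ = λ b → eigenvalue b k
      I⇄Λ : I ⊙ diag μ ≈ᴹ diag μ ⊙ I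
      I⇄Λ = ≈ᴹ-trans (⊙-identityˡ (diag μ)) (≈ᴹ-sym (⊙-identityʳ (diag μ)))

    α-eigen : ∀ b k → α b * eigenvalue b k ≈ α b * eigenvalue i k
    α-eigen b k = trans (α-eigenʲ b k) (*-congˡ (sym (*-cancelˡ-≉0 αᵢ≉0 (α-eigenʲ i k))))

  dropRedundant : ∀ {q p t} {Z : Fin p → Mat q q} (E : EigenFrame Z (suc t)) →
                  ¬ EigenFrame.Y E ⊙ EigenFrame.X E ≈ᴹ I → DoubleNegation (EigenFrame Z t)
  dropRedundant E N≉I = do
    i , Nᵢ≉Iᵢ ← ¬∀⇒¬¬∃¬ N≉I
    j , Nᵢⱼ≉δᵢⱼ ← ¬∀⇒¬¬∃¬ Nᵢ≉Iᵢ
    let open KernelVector E i j Nᵢⱼ≉δᵢⱼ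
    return (DropColumn.frame E i α X⊙α≈0 αᵢ≉0 α-eigen)

  twoSided⇒diagonalization : ∀ {q p t} {Z : Fin p → Mat q q} → TwoSidedFrame Z t → Diagonalization Z
  twoSided⇒diagonalization {Z = Z} (E , Y⊙X≈I) = ≡.subst (TwoSidedFrame Z) t≡q (E , Y⊙X≈I)
    where
    open EigenFrame E
    t≡q = ℕ.≤-antisym (hasRightInverse⇒≤ Y X Y⊙X≈I) (hasRightInverse⇒≤ X Y X⊙Y≈I)

  diagonalize : ∀ {q p t} {Z : Fin p → Mat q q} → EigenFrame Z t → DoubleNegation (Diagonalization Z)
  diagonalize {t = zero}  E = return (twoSided⇒diagonalization (E , λ ()))
  diagonalize {t = suc t} E = ¬¬-excluded-middle >>= λ where
    (yes Y⊙X≈I) → return (twoSided⇒diagonalization (E , Y⊙X≈I))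
    (no Y⊙X≉I)  → dropRedundant E Y⊙X≉I >>= diagonalize

  -- Π a selects the columns of X whose class of equal eigenvalue vectors has leader a, so
  -- Φ a = X Π a Y projects onto a joint eigenspace of Z ∘ suc (or is zero). Z₀ commutes with these projectors, so the
  -- columns of Φ a P and the rows of Q Φ a, for all a, form an eigenframe of the whole family.
  module Refinement {q p t u} (Z : Fin (suc p) → Mat q q) (Z-comm : ∀ k l → Z k ⊙ Z l ≈ᴹ Z l ⊙ Z k)
                    (E : EigenFrame (Z ∘ suc) t) (Y⊙X≈I : EigenFrame.Y E ⊙ EigenFrame.X E ≈ᴹ I)
                    (E₀ : EigenFrame (λ (_ : Fin 1) → Z zero) u)
                    (_≟ᵉ_ : ∀ b b′ k → Dec (EigenFrame.eigenvalue E b k ≈ EigenFrame.eigenvalue E b′ k)) where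
    open EigenFrame E
    open EigenFrame E₀ using () renaming (X to P; Y to Q; eigenvalue to d; X⊙Y≈I to P⊙Q≈I; Z⊙X≈X⊙Λ to Z₀⊙P≈P⊙D; Y⊙Z≈Λ⊙Y to Q⊙Z₀≈D⊙Q)

    Z₀ : Mat q q
    Z₀ = Z zero

    Λ : Fin p → Mat t t
    Λ k = diag (λ b → eigenvalue b k)

    _~_ : Fin t → Fin t → Set ℓ
    b ~ b′ = ∀ k → eigenvalue b k ≈ eigenvalue b′ k

    _~?_ : ∀ b b′ → Dec (b ~ b′)
    b ~? b′ = Fin.all? (b ≟ᵉ b′)

    leader : Fin t → Fin t
    leader b = first (_~? b) b

    leader-~ : ∀ b → leader b ~ b
    leader-~ b = first-satisfies (_~? b) (λ k → refl)

    leader-cong : ∀ {b b′} → b ~ b′ → leader b ≡ leader b′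
    leader-cong b~b′ = first-cong (_~? _) (_~? _) (λ a a~b k → trans (a~b k) (b~b′ k))
                                  (λ a a~b′ k → trans (a~b′ k) (sym (b~b′ k))) (λ k → refl) (λ k → refl)

    W : Mat t t
    W = Y ⊙ Z₀ ⊙ X

    W⇄Λ : ∀ k → W ⊙ Λ k ≈ᴹ Λ k ⊙ W
    W⇄Λ k = begin
      Y ⊙ Z₀ ⊙ X ⊙ Λ k           ≈⟨ ⊙-assoc (Y ⊙ Z₀) X (Λ k) ⟩
      Y ⊙ Z₀ ⊙ (X ⊙ Λ k)         ≈⟨ ⊙-congˡ (Z⊙X≈X⊙Λ k) ⟨
      Y ⊙ Z₀ ⊙ (Z (suc k) ⊙ X)   ≈⟨ ⊙-assoc Y Z₀ (Z (suc k) ⊙ X) ⟩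
      Y ⊙ (Z₀ ⊙ (Z (suc k) ⊙ X)) ≈⟨ ⊙-congˡ (⊙-assoc Z₀ (Z (suc k)) X) ⟨
      Y ⊙ (Z₀ ⊙ Z (suc k) ⊙ X)   ≈⟨ ⊙-congˡ (⊙-congʳ (Z-comm zero (suc k))) ⟩
      Y ⊙ (Z (suc k) ⊙ Z₀ ⊙ X)   ≈⟨ ⊙-congˡ (⊙-assoc (Z (suc k)) Z₀ X) ⟩
      Y ⊙ (Z (suc k) ⊙ (Z₀ ⊙ X)) ≈⟨ ⊙-assoc Y (Z (suc k)) (Z₀ ⊙ X) ⟨
      Y ⊙ Z (suc k) ⊙ (Z₀ ⊙ X)   ≈⟨ ⊙-congʳ (Y⊙Z≈Λ⊙Y k) ⟩
      Λ k ⊙ Y ⊙ (Z₀ ⊙ X)         ≈⟨ ⊙-assoc (Λ k) Y (Z₀ ⊙ X) ⟩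
      Λ k ⊙ (Y ⊙ (Z₀ ⊙ X))       ≈⟨ ⊙-congˡ (⊙-assoc Y Z₀ X) ⟨
      Λ k ⊙ W                    ∎
      where open ≈ᴹ-Reasoning

    -- Commuting with every Λ k, W = Y Z₀ X is block diagonal for the classes of equal
    -- eigenvalue vectors.
    W-offClass≈0 : ∀ b b′ → leader b ≢ leader b′ → W b b′ ≈ 0#
    W-offClass≈0 b b′ leaders≢ = *-cancelˡ-≉0 μb′-μb≉0 (begin
      (μ b′ - μ b) * W b b′        ≈⟨ [y-z]x≈yx-zx (W b b′) _ _ ⟩
      μ b′ * W b b′ - μ b * W b b′  ≈⟨ +-congʳ (trans (*-comm _ _) (⊙-diag-commute (W⇄Λ k) b b′)) ⟩
      μ b * W b b′ - μ b * W b b′   ≈⟨ -‿inverseʳ _ ⟩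
      0#                          ≈⟨ zeroʳ _ ⟨
      (μ b′ - μ b) * 0#            ∎)
      where
      open ≈-Reasoning
      separating : ∃ λ k → ¬ eigenvalue b k ≈ eigenvalue b′ k
      separating = Fin.¬∀⟶∃¬ p _ (b ≟ᵉ b′) (leaders≢ ∘ leader-cong)
      k = proj₁ separating
      μ = λ b → eigenvalue b k
      μb′-μb≉0 : ¬ μ b′ - μ b ≈ 0#
      μb′-μb≉0 μb′-μb≈0 = proj₂ separating (sym (x∙y⁻¹≈ε⇒x≈y _ _ μb′-μb≈0))

    π : Fin t → Fin t → Carrier
    π a b = δ (leader b) a

    Π : Fin t → Mat t t
    Π a = diag (π a)

    ∑π≈1 : ∀ b → ∑[ a < t ] π a b ≈ 1#
    ∑π≈1 b = trans (sum-cong-≋ {t} (λ a → sym (*-identityʳ (π a b)))) (∑-δˡ (leader b) (λ _ → 1#))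

    Π-idempotent : ∀ a → Π a ⊙ Π a ≈ᴹ Π a
    Π-idempotent a = ≈ᴹ-trans (diag-⊙-diag (π a) (π a)) (diag-cong (λ b → δ-idempotent (leader b) a))

    W⇄Π : ∀ a → W ⊙ Π a ≈ᴹ Π a ⊙ W
    W⇄Π a b b′ = trans (⊙-diag W (π a) b b′) (trans (commute (leader b Fin.≟ leader b′)) (sym (diag-⊙ (π a) W b b′)))
      where
      commute : Dec (leader b ≡ leader b′) → W b b′ * π a b′ ≈ π a b * W b b′
      commute (yes leaders≡) = trans (*-comm _ _) (*-congʳ (reflexive (≡.cong (λ l → δ l a) (≡.sym leaders≡))))
      commute (no leaders≢)  = trans (*-congʳ (W-offClass≈0 b b′ leaders≢))
                                 (trans (zeroˡ _) (sym (trans (*-congˡ (W-offClass≈0 b b′ leaders≢)) (zeroʳ _))))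

    Λ⊙Π≈⋆Π : ∀ k a → Λ k ⊙ Π a ≈ᴹ eigenvalue a k ⋆ Π a
    Λ⊙Π≈⋆Π k a = ≈ᴹ-trans (diag-⊙-diag _ (π a)) (≈ᴹ-trans (diag-cong onClass) (diag-scale (eigenvalue a k) (π a)))
      where
      onClass : ∀ b → eigenvalue b k * π a b ≈ eigenvalue a k * π a b
      onClass b with leader b Fin.≟ a
      ... | yes ≡.refl = *-congʳ (sym (leader-~ b k))
      ... | no  b∉a    = trans (*-congˡ (δ-off b∉a)) (trans (zeroʳ _) (sym (trans (*-congˡ (δ-off b∉a)) (zeroʳ _))))

    Π⊙Λ≈⋆Π : ∀ k a → Π a ⊙ Λ k ≈ᴹ eigenvalue a k ⋆ Π a
    Π⊙Λ≈⋆Π k a = ≈ᴹ-trans (diag-comm (π a) _) (Λ⊙Π≈⋆Π k a)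

    Φ : Fin t → Mat q q
    Φ a = X ⊙ Π a ⊙ Y

    Φ-idempotent : ∀ a → Φ a ⊙ Φ a ≈ᴹ Φ a
    Φ-idempotent a = begin
      X ⊙ Π a ⊙ Y ⊙ (X ⊙ Π a ⊙ Y)     ≈⟨ ⊙-assoc (X ⊙ Π a) Y (X ⊙ Π a ⊙ Y) ⟩
      X ⊙ Π a ⊙ (Y ⊙ (X ⊙ Π a ⊙ Y))   ≈⟨ ⊙-congˡ (⊙-congˡ (⊙-assoc X (Π a) Y)) ⟩
      X ⊙ Π a ⊙ (Y ⊙ (X ⊙ (Π a ⊙ Y))) ≈⟨ ⊙-congˡ (⊙-cancelˡ Y⊙X≈I (Π a ⊙ Y)) ⟩
      X ⊙ Π a ⊙ (Π a ⊙ Y)             ≈⟨ ⊙-assoc X (Π a) (Π a ⊙ Y) ⟩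
      X ⊙ (Π a ⊙ (Π a ⊙ Y))           ≈⟨ ⊙-congˡ (⊙-assoc (Π a) (Π a) Y) ⟨
      X ⊙ (Π a ⊙ Π a ⊙ Y)             ≈⟨ ⊙-congˡ (⊙-congʳ (Π-idempotent a)) ⟩
      X ⊙ (Π a ⊙ Y)                   ≈⟨ ⊙-assoc X (Π a) Y ⟨
      Φ a                             ∎
      where open ≈ᴹ-Reasoning

    Z₀⇄Φ : ∀ a → Z₀ ⊙ Φ a ≈ᴹ Φ a ⊙ Z₀
    Z₀⇄Φ a = begin
      Z₀ ⊙ (X ⊙ Π a ⊙ Y)     ≈⟨ ⊙-assoc Z₀ (X ⊙ Π a) Y ⟨
      Z₀ ⊙ (X ⊙ Π a) ⊙ Y     ≈⟨ ⊙-congʳ (⊙-assoc Z₀ X (Π a)) ⟨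
      Z₀ ⊙ X ⊙ Π a ⊙ Y       ≈⟨ ⊙-congʳ (⊙-congʳ Z₀⊙X≈X⊙W) ⟩
      X ⊙ W ⊙ Π a ⊙ Y        ≈⟨ ⊙-congʳ (≈ᴹ-trans (⊙-assoc X W (Π a)) (≈ᴹ-trans (⊙-congˡ (W⇄Π a)) (≈ᴹ-sym (⊙-assoc X (Π a) W)))) ⟩
      X ⊙ Π a ⊙ W ⊙ Y        ≈⟨ ⊙-assoc (X ⊙ Π a) W Y ⟩
      X ⊙ Π a ⊙ (W ⊙ Y)      ≈⟨ ⊙-congˡ Y⊙Z₀≈W⊙Y ⟨
      X ⊙ Π a ⊙ (Y ⊙ Z₀)     ≈⟨ ⊙-assoc (X ⊙ Π a) Y Z₀ ⟨
      Φ a ⊙ Z₀               ∎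
      where
      open ≈ᴹ-Reasoning
      Z₀⊙X≈X⊙W : Z₀ ⊙ X ≈ᴹ X ⊙ W
      Z₀⊙X≈X⊙W = ≈ᴹ-trans (≈ᴹ-sym (⊙-cancelˡ X⊙Y≈I (Z₀ ⊙ X))) (⊙-congˡ (≈ᴹ-sym (⊙-assoc Y Z₀ X)))
      Y⊙Z₀≈W⊙Y : Y ⊙ Z₀ ≈ᴹ W ⊙ Y
      Y⊙Z₀≈W⊙Y = ≈ᴹ-sym (⊙-cancelʳ X⊙Y≈I (Y ⊙ Z₀))

    Z⊙Φ≈⋆Φ : ∀ k a → Z (suc k) ⊙ Φ a ≈ᴹ eigenvalue a k ⋆ Φ a
    Z⊙Φ≈⋆Φ k a = begin
      Z (suc k) ⊙ (X ⊙ Π a ⊙ Y)       ≈⟨ ⊙-assoc (Z (suc k)) (X ⊙ Π a) Y ⟨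
      Z (suc k) ⊙ (X ⊙ Π a) ⊙ Y       ≈⟨ ⊙-congʳ (⊙-assoc (Z (suc k)) X (Π a)) ⟨
      Z (suc k) ⊙ X ⊙ Π a ⊙ Y         ≈⟨ ⊙-congʳ (⊙-congʳ (Z⊙X≈X⊙Λ k)) ⟩
      X ⊙ Λ k ⊙ Π a ⊙ Y               ≈⟨ ⊙-congʳ (⊙-assoc X (Λ k) (Π a)) ⟩
      X ⊙ (Λ k ⊙ Π a) ⊙ Y             ≈⟨ ⊙-congʳ (⊙-congˡ (Λ⊙Π≈⋆Π k a)) ⟩
      X ⊙ (μ ⋆ Π a) ⊙ Y               ≈⟨ ⊙-congʳ (⊙-⋆ μ X (Π a)) ⟩
      μ ⋆ (X ⊙ Π a) ⊙ Y               ≈⟨ ⋆-⊙ μ (X ⊙ Π a) Y ⟩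
      μ ⋆ Φ a                         ∎
      where
      open ≈ᴹ-Reasoning
      μ = eigenvalue a k

    Φ⊙Z≈⋆Φ : ∀ k a → Φ a ⊙ Z (suc k) ≈ᴹ eigenvalue a k ⋆ Φ a
    Φ⊙Z≈⋆Φ k a = begin
      X ⊙ Π a ⊙ Y ⊙ Z (suc k)         ≈⟨ ⊙-assoc (X ⊙ Π a) Y (Z (suc k)) ⟩
      X ⊙ Π a ⊙ (Y ⊙ Z (suc k))       ≈⟨ ⊙-congˡ (Y⊙Z≈Λ⊙Y k) ⟩
      X ⊙ Π a ⊙ (Λ k ⊙ Y)             ≈⟨ ⊙-assoc (X ⊙ Π a) (Λ k) Y ⟨
      X ⊙ Π a ⊙ Λ k ⊙ Y               ≈⟨ ⊙-congʳ (⊙-assoc X (Π a) (Λ k)) ⟩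
      X ⊙ (Π a ⊙ Λ k) ⊙ Y             ≈⟨ ⊙-congʳ (⊙-congˡ (Π⊙Λ≈⋆Π k a)) ⟩
      X ⊙ (μ ⋆ Π a) ⊙ Y               ≈⟨ ⊙-congʳ (⊙-⋆ μ X (Π a)) ⟩
      μ ⋆ (X ⊙ Π a) ⊙ Y               ≈⟨ ⋆-⊙ μ (X ⊙ Π a) Y ⟩
      μ ⋆ Φ a                         ∎
      where
      open ≈ᴹ-Reasoning
      μ = eigenvalue a k

    ∑Φ≈I : ∀ i j → ∑[ a < t ] Φ a i j ≈ δ i j
    ∑Φ≈I i j = begin
      ∑[ a < t ] Φ a i j                                  ≈⟨ sum-cong-≋ {t} (λ a → entry a) ⟩
      ∑[ a < t ] ∑[ b < t ] (π a b * (X i b * Y b j))     ≈⟨ ∑-comm {t} {t} _ ⟩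
      ∑[ b < t ] ∑[ a < t ] (π a b * (X i b * Y b j))     ≈⟨ sum-cong-≋ {t} (λ b → *-distribʳ-sum {t} (X i b * Y b j) (λ a → π a b)) ⟨
      ∑[ b < t ] (∑[ a < t ] π a b * (X i b * Y b j))     ≈⟨ sum-cong-≋ {t} (λ b → trans (*-congʳ (∑π≈1 b)) (*-identityˡ _)) ⟩
      ∑[ b < t ] (X i b * Y b j)                          ≡⟨ ⊙-entry X Y i j ⟨
      (X ⊙ Y) i j                                        ≈⟨ X⊙Y≈I i j ⟩
      δ i j                                              ∎
      where
      open ≈-Reasoning
      entry : ∀ a → Φ a i j ≈ ∑[ b < t ] (π a b * (X i b * Y b j))
      entry a = begin
        (X ⊙ Π a ⊙ Y) i j                        ≡⟨ ⊙-entry (X ⊙ Π a) Y i j ⟩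
        ∑[ b < t ] ((X ⊙ Π a) i b * Y b j)        ≈⟨ sum-cong-≋ {t} (λ b → *-congʳ (⊙-diag X (π a) i b)) ⟩
        ∑[ b < t ] ((X i b * π a b) * Y b j)      ≈⟨ sum-cong-≋ {t} (λ b → xy∙z≈y∙xz _ _ _) ⟩
        ∑[ b < t ] (π a b * (X i b * Y b j))      ∎

    refinedEigenvalue : Fin t → Fin u → Fin (suc p) → Carrier
    refinedEigenvalue a l zero    = d l zero
    refinedEigenvalue a l (suc k) = eigenvalue a k

    Φ⊙P-eigen : ∀ k a → Z k ⊙ (Φ a ⊙ P) ≈ᴹ Φ a ⊙ P ⊙ diag (λ l → refinedEigenvalue a l k)
    Φ⊙P-eigen zero a = begin
      Z₀ ⊙ (Φ a ⊙ P)                 ≈⟨ ⊙-assoc Z₀ (Φ a) P ⟨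
      Z₀ ⊙ Φ a ⊙ P                   ≈⟨ ⊙-congʳ (Z₀⇄Φ a) ⟩
      Φ a ⊙ Z₀ ⊙ P                   ≈⟨ ⊙-assoc (Φ a) Z₀ P ⟩
      Φ a ⊙ (Z₀ ⊙ P)                 ≈⟨ ⊙-congˡ (Z₀⊙P≈P⊙D zero) ⟩
      Φ a ⊙ (P ⊙ diag (λ l → d l zero)) ≈⟨ ⊙-assoc (Φ a) P _ ⟨
      Φ a ⊙ P ⊙ diag (λ l → d l zero)   ∎
      where open ≈ᴹ-Reasoning
    Φ⊙P-eigen (suc k) a = begin
      Z (suc k) ⊙ (Φ a ⊙ P)          ≈⟨ ⊙-assoc (Z (suc k)) (Φ a) P ⟨
      Z (suc k) ⊙ Φ a ⊙ P            ≈⟨ ⊙-congʳ (Z⊙Φ≈⋆Φ k a) ⟩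
      μ ⋆ Φ a ⊙ P                    ≈⟨ ⋆-⊙ μ (Φ a) P ⟩
      μ ⋆ (Φ a ⊙ P)                  ≈⟨ ⋆≈⊙diag μ (Φ a ⊙ P) ⟩
      Φ a ⊙ P ⊙ diag (λ _ → μ)       ∎
      where
      open ≈ᴹ-Reasoning
      μ = eigenvalue a k

    Q⊙Φ-eigen : ∀ k a → Q ⊙ Φ a ⊙ Z k ≈ᴹ diag (λ l → refinedEigenvalue a l k) ⊙ (Q ⊙ Φ a)
    Q⊙Φ-eigen zero a = begin
      Q ⊙ Φ a ⊙ Z₀                   ≈⟨ ⊙-assoc Q (Φ a) Z₀ ⟩
      Q ⊙ (Φ a ⊙ Z₀)                 ≈⟨ ⊙-congˡ (Z₀⇄Φ a) ⟨
      Q ⊙ (Z₀ ⊙ Φ a)                 ≈⟨ ⊙-assoc Q Z₀ (Φ a) ⟨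
      Q ⊙ Z₀ ⊙ Φ a                   ≈⟨ ⊙-congʳ (Q⊙Z₀≈D⊙Q zero) ⟩
      diag (λ l → d l zero) ⊙ Q ⊙ Φ a   ≈⟨ ⊙-assoc _ Q (Φ a) ⟩
      diag (λ l → d l zero) ⊙ (Q ⊙ Φ a) ∎
      where open ≈ᴹ-Reasoning
    Q⊙Φ-eigen (suc k) a = begin
      Q ⊙ Φ a ⊙ Z (suc k)            ≈⟨ ⊙-assoc Q (Φ a) (Z (suc k)) ⟩
      Q ⊙ (Φ a ⊙ Z (suc k))          ≈⟨ ⊙-congˡ (Φ⊙Z≈⋆Φ k a) ⟩
      Q ⊙ (μ ⋆ Φ a)                  ≈⟨ ⊙-⋆ μ Q (Φ a) ⟩
      μ ⋆ (Q ⊙ Φ a)                  ≈⟨ ⋆≈diag⊙ μ (Q ⊙ Φ a) ⟩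
      diag (λ _ → μ) ⊙ (Q ⊙ Φ a)     ∎
      where
      open ≈ᴹ-Reasoning
      μ = eigenvalue a k

    frame : EigenFrame Z (t ℕ.* u)
    frame = record
      { X = columns (λ a → Φ a ⊙ P)
      ; Y = rows (λ a → Q ⊙ Φ a)
      ; eigenvalue = λ x k → blockwise (λ a l → refinedEigenvalue a l k) x
      ; X⊙Y≈I = λ i j → trans (columns-⊙-rows {t = t} (λ a → Φ a ⊙ P) (λ a → Q ⊙ Φ a) i j)
                              (trans (sum-cong-≋ {t} (λ a → block a i j)) (∑Φ≈I i j))
      ; Z⊙X≈X⊙Λ = λ k → columns-eigen (Z k) (λ a → Φ a ⊙ P) _ (Φ⊙P-eigen k)
      ; Y⊙Z≈Λ⊙Y = λ k → rows-eigen (Z k) (λ a → Q ⊙ Φ a) _ (Q⊙Φ-eigen k)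
      }
      where
      block : ∀ a → Φ a ⊙ P ⊙ (Q ⊙ Φ a) ≈ᴹ Φ a
      block a = ≈ᴹ-trans (⊙-assoc (Φ a) P (Q ⊙ Φ a)) (≈ᴹ-trans (⊙-congˡ (⊙-cancelˡ P⊙Q≈I (Φ a))) (Φ-idempotent a))

  simultaneouslyDiagonalizable : ∀ {q} p (Z : Fin p → Mat q q) → (∀ k l → Z k ⊙ Z l ≈ᴹ Z l ⊙ Z k) →
                                 (∀ k → Diagonalizable (Z k)) → DoubleNegation (Diagonalization Z)
  simultaneouslyDiagonalizable zero Z _ _ = return (identityFrame , ⊙-identityˡ I)
    where
    identityFrame : EigenFrame Z _
    identityFrame = record
      { X = I ; Y = I ; eigenvalue = λ _ () ; X⊙Y≈I = ⊙-identityˡ I ; Z⊙X≈X⊙Λ = λ () ; Y⊙Z≈Λ⊙Y = λ () }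
  simultaneouslyDiagonalizable (suc p) Z Z-comm Z-diagonalizable = do
    E , Y⊙X≈I ← simultaneouslyDiagonalizable p (Z ∘ suc) (λ k l → Z-comm (suc k) (suc l)) (Z-diagonalizable ∘ suc)
    _≟ᵉ_ ← ¬¬-∀-Fin λ b → ¬¬-∀-Fin λ b′ → ¬¬-∀-Fin λ k → ¬¬-excluded-middle
    let E₀ = proj₁ (diagonalizable⇒diagonalization (Z-diagonalizable zero))
    diagonalize (Refinement.frame Z Z-comm E Y⊙X≈I E₀ _≟ᵉ_)

  -- The lower bound

  module _ {q p t} {Z : Fin p → Mat q q} (E : EigenFrame Z t) where
    open EigenFrame E

    frameDecomposition : Decomposition q q (suc p) t
    frameDecomposition = record { u = λ l i → X i l ; v = λ l j → Y l j ; w = λ l → 1# ∷ eigenvalue l }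

    ⟦frameDecomposition⟧-zero : ∀ i j → ⟦ frameDecomposition ⟧ i j zero ≈ δ i j
    ⟦frameDecomposition⟧-zero i j = begin
      ∑[ l < t ] ((X i l * Y l j) * 1#) ≈⟨ sum-cong-≋ {t} (λ l → *-identityʳ _) ⟩
      ∑[ l < t ] (X i l * Y l j)        ≡⟨ ⊙-entry X Y i j ⟨
      (X ⊙ Y) i j                     ≈⟨ X⊙Y≈I i j ⟩
      δ i j                           ∎
      where open ≈-Reasoning

    ⟦frameDecomposition⟧-suc : ∀ i j k → ⟦ frameDecomposition ⟧ i j (suc k) ≈ Z k i j
    ⟦frameDecomposition⟧-suc i j k = begin
      ∑[ l < t ] ((X i l * Y l j) * μ l)     ≈⟨ sum-cong-≋ {t} (λ l → trans (xy∙z≈xz∙y _ _ _) (*-congʳ (sym (⊙-diag X μ i l)))) ⟩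
      ∑[ l < t ] ((X ⊙ diag μ) i l * Y l j)  ≡⟨ ⊙-entry (X ⊙ diag μ) Y i j ⟨
      (X ⊙ diag μ ⊙ Y) i j                 ≈⟨ ⊙-congʳ (Z⊙X≈X⊙Λ k) i j ⟨
      (Z k ⊙ X ⊙ Y) i j                    ≈⟨ ⊙-cancelʳ X⊙Y≈I (Z k) i j ⟩
      Z k i j                              ∎
      where
      open ≈-Reasoning
      μ = λ l → eigenvalue l k

  module _ {m n p} (T : Tensor m n p) where

    blockA-↑ˡ-↑ʳ : ∀ k a b → blockA T k (a ↑ˡ n) (m ↑ʳ b) ≡ T a b k
    blockA-↑ˡ-↑ʳ k a b rewrite Fin.splitAt-↑ˡ m a n | Fin.splitAt-↑ʳ m n b = ≡.refl

    blockA-↑ˡ-↑ˡ : ∀ k a a′ → blockA T k (a ↑ˡ n) (a′ ↑ˡ n) ≡ 0#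
    blockA-↑ˡ-↑ˡ k a a′ rewrite Fin.splitAt-↑ˡ m a n | Fin.splitAt-↑ˡ m a′ n = ≡.refl

    blockA-↑ʳ : ∀ k b j → blockA T k (m ↑ʳ b) j ≡ 0#
    blockA-↑ʳ k b j rewrite Fin.splitAt-↑ʳ m n b with Fin.splitAt m j
    ... | inj₁ _ = ≡.refl
    ... | inj₂ _ = ≡.refl

    -- Substitution method: the last n rows and then the first m columns of the tensor
    -- (I, A₁, …, Aₚ) are unit vectors in slice zero, and removing them leaves T.
    blockDecomposition⇒decomposition :
      ∀ {t} (D : Decomposition (m ℕ.+ n) (m ℕ.+ n) (suc p) t) →
      (∀ i j → ⟦ D ⟧ i j zero ≈ δ i j) → (∀ i j k → ⟦ D ⟧ i j (suc k) ≈ blockA T k i j) →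
      DoubleNegation (Σ ℕ λ r′ → HasDecomposition T r′ × r′ ℕ.+ m ℕ.+ n ℕ.≤ t)
    blockDecomposition⇒decomposition {t} D D₀≈I D₊≈A = do
        t₁ , n+t₁≤t , D₁ , D₁≈ ← eliminate-unit-rows n (reindex lowerFirst id id D) (m ↑ʳ_) (λ _ → zero) unit₀
        let open Stage₁ D₁ D₁≈
        t₂ , m+t₂≤t₁ , D₂ , D₂≈ ← eliminate-unit-rows m (transpose D₁) id (λ _ → zero) unit₁
        return (t₂ , Decomposition⇒HasDecomposition (reindex id id suc (transpose D₂)) (T≈ D₂ D₂≈) ,
                bound n+t₁≤t m+t₂≤t₁)
      where
      lowerFirst : Fin (n ℕ.+ m) → Fin (m ℕ.+ n)
      lowerFirst = Fin.join m n ∘ Sum.swap ∘ Fin.splitAt n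

      lowerFirst-↑ˡ : ∀ b → lowerFirst (b ↑ˡ m) ≡ m ↑ʳ b
      lowerFirst-↑ˡ b = ≡.cong (Fin.join m n ∘ Sum.swap) (Fin.splitAt-↑ˡ n b m)

      lowerFirst-↑ʳ : ∀ a → lowerFirst (n ↑ʳ a) ≡ a ↑ˡ n
      lowerFirst-↑ʳ a = ≡.cong (Fin.join m n ∘ Sum.swap) (Fin.splitAt-↑ʳ n m a)

      unit₀ : ∀ x y → ⟦ D ⟧ (lowerFirst (x ↑ˡ m)) (m ↑ʳ y) zero ≈ δ x y
      unit₀ x y = trans (reflexive (≡.cong (λ i → ⟦ D ⟧ i (m ↑ʳ y) zero) (lowerFirst-↑ˡ x)))
                        (trans (D₀≈I _ _) (δ-injective (Fin.↑ʳ-injective m _ _) x y))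

      module Stage₁ {t₁} (D₁ : Decomposition m (m ℕ.+ n) (suc p) t₁)
                    (D₁≈ : ∀ a j k → (∀ x → ⟦ D ⟧ (lowerFirst (x ↑ˡ m)) j k ≈ 0#) →
                           ⟦ D₁ ⟧ a j k ≈ ⟦ D ⟧ (lowerFirst (n ↑ʳ a)) j k) where
        D₁-kept : ∀ a j k → (∀ x → ⟦ D ⟧ (m ↑ʳ x) j k ≈ 0#) → ⟦ D₁ ⟧ a j k ≈ ⟦ D ⟧ (a ↑ˡ n) j k
        D₁-kept a j k vanish = trans (D₁≈ a j k (λ x → trans (reflexive (≡.cong (λ i → ⟦ D ⟧ i j k) (lowerFirst-↑ˡ x))) (vanish x)))
                                     (reflexive (≡.cong (λ i → ⟦ D ⟧ i j k) (lowerFirst-↑ʳ a)))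

        D₁₊≈A : ∀ a j k → ⟦ D₁ ⟧ a j (suc k) ≈ blockA T k (a ↑ˡ n) j
        D₁₊≈A a j k = trans (D₁-kept a j (suc k) (λ x → trans (D₊≈A _ j k) (reflexive (blockA-↑ʳ k x j)))) (D₊≈A _ j k)

        D₁₀≈I : ∀ a a′ → ⟦ D₁ ⟧ a (a′ ↑ˡ n) zero ≈ δ a a′
        D₁₀≈I a a′ = trans (D₁-kept a _ zero (λ x → trans (D₀≈I _ _) (δ-off (↑ʳ≢↑ˡ x a′))))
                           (trans (D₀≈I _ _) (δ-injective (Fin.↑ˡ-injective n _ _) a a′))

        unit₁ : ∀ x y → ⟦ transpose D₁ ⟧ (x ↑ˡ n) y zero ≈ δ x y
        unit₁ x y = trans (⟦transpose⟧ D₁ y _ zero) (trans (D₁₀≈I y x) (δ-sym y x))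

        T≈ : ∀ {t₂} (D₂ : Decomposition n m (suc p) t₂) →
             (∀ b a k → (∀ x → ⟦ transpose D₁ ⟧ (x ↑ˡ n) a k ≈ 0#) → ⟦ D₂ ⟧ b a k ≈ ⟦ transpose D₁ ⟧ (m ↑ʳ b) a k) →
             ∀ a b k → T a b k ≈ ⟦ transpose D₂ ⟧ a b (suc k)
        T≈ D₂ D₂≈ a b k = sym (begin
          ⟦ transpose D₂ ⟧ a b (suc k)     ≈⟨ ⟦transpose⟧ D₂ b a (suc k) ⟩
          ⟦ D₂ ⟧ b a (suc k)
            ≈⟨ D₂≈ b a (suc k) (λ x → trans (⟦transpose⟧ D₁ a _ _) (trans (D₁₊≈A a _ k) (reflexive (blockA-↑ˡ-↑ˡ k a x)))) ⟩
          ⟦ transpose D₁ ⟧ (m ↑ʳ b) a (suc k) ≈⟨ ⟦transpose⟧ D₁ a _ _ ⟩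
          ⟦ D₁ ⟧ a (m ↑ʳ b) (suc k)        ≈⟨ D₁₊≈A a _ k ⟩
          blockA T k (a ↑ˡ n) (m ↑ʳ b)     ≡⟨ blockA-↑ˡ-↑ʳ k a b ⟩
          T a b k                          ∎)
          where open ≈-Reasoning

      bound : ∀ {t₁ t₂} → n ℕ.+ t₁ ℕ.≤ t → m ℕ.+ t₂ ℕ.≤ t₁ → t₂ ℕ.+ m ℕ.+ n ℕ.≤ t
      bound {t₁} {t₂} n+t₁≤t m+t₂≤t₁ = begin
        t₂ ℕ.+ m ℕ.+ n    ≡⟨ ℕ.+-comm (t₂ ℕ.+ m) n ⟩
        n ℕ.+ (t₂ ℕ.+ m)  ≡⟨ ≡.cong (n ℕ.+_) (ℕ.+-comm t₂ m) ⟩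
        n ℕ.+ (m ℕ.+ t₂)  ≤⟨ ℕ.+-monoʳ-≤ n m+t₂≤t₁ ⟩
        n ℕ.+ t₁          ≤⟨ n+t₁≤t ⟩
        t                 ∎
        where open ℕ.≤-Reasoning

    lowerBound : ∀ {r s} → (∀ r′ → HasDecomposition T r′ → r ℕ.≤ r′) → DiagCommExt (blockA T) s →
                 r ℕ.+ m ℕ.+ n ℕ.≤ s
    lowerBound {r} {s} minimal (m+n≤s , Z , Z-comm , Z-diagonalizable , Z-extends) =
      decidable-stable (r ℕ.+ m ℕ.+ n ℕ.≤? s) (do
        E , _ ← simultaneouslyDiagonalizable p Z Z-comm′ Z-diagonalizable
        r′ , T-decomposition , r′+m+n≤s ← blockDecomposition⇒decomposition (reindex ι ι id (frameDecomposition E)) (unit E) (extends E)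
        return (ℕ.≤-trans (ℕ.+-monoˡ-≤ n (ℕ.+-monoˡ-≤ m (minimal r′ T-decomposition))) r′+m+n≤s))
      where
      ι : Fin (m ℕ.+ n) → Fin s
      ι i = Fin.inject≤ i m+n≤s

      Z-comm′ : ∀ k l → Z k ⊙ Z l ≈ᴹ Z l ⊙ Z k
      Z-comm′ k l = ≈ᴹ-trans (⊙≈· (Z k) (Z l)) (≈ᴹ-trans (Z-comm k l) (≈ᴹ-sym (⊙≈· (Z l) (Z k))))

      module _ (E : EigenFrame Z s) where
        unit : ∀ i j → ⟦ frameDecomposition E ⟧ (ι i) (ι j) zero ≈ δ i j
        unit i j = trans (⟦frameDecomposition⟧-zero E (ι i) (ι j)) (δ-injective (Fin.inject≤-injective m+n≤s m+n≤s _ _) i j)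

        extends : ∀ i j k → ⟦ frameDecomposition E ⟧ (ι i) (ι j) (suc k) ≈ blockA T k i j
        extends i j k = trans (⟦frameDecomposition⟧-suc E (ι i) (ι j) k) (Z-extends k i j)

  -- The upper bound

  O : ∀ {a b} → Mat a b
  O _ _ = 0#

  I+_ : ∀ {a} → Mat a a → Mat a a
  (I+ A) i j = δ i j + A i j

  unipotent-inverse : ∀ {a} (A B : Mat a a) → (∀ i j → A i j + B i j ≈ 0#) → A ⊙ B ≈ᴹ O → (I+ A) ⊙ (I+ B) ≈ᴹ I
  unipotent-inverse {a} A B A+B≈0 A⊙B≈0 i j = begin
    ((I+ A) ⊙ (I+ B)) i j                                            ≡⟨ ⊙-entry (I+ A) (I+ B) i j ⟩
    ∑[ z < a ] ((δ i z + A i z) * (I+ B) z j)                          ≈⟨ sum-cong-≋ {a} (λ z → distribʳ _ _ _) ⟩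
    ∑[ z < a ] (δ i z * (I+ B) z j + A i z * (δ z j + B z j))          ≈⟨ ∑-distrib-+ {a} _ _ ⟩
    ∑[ z < a ] (δ i z * (I+ B) z j) + ∑[ z < a ] (A i z * (δ z j + B z j))
      ≈⟨ +-cong (∑-δˡ i (λ z → (I+ B) z j)) (sum-cong-≋ {a} (λ z → distribˡ _ _ _)) ⟩
    (δ i j + B i j) + ∑[ z < a ] (A i z * δ z j + A i z * B z j)        ≈⟨ +-congˡ (∑-distrib-+ {a} _ _) ⟩
    (δ i j + B i j) + (∑[ z < a ] (A i z * δ z j) + ∑[ z < a ] (A i z * B z j))
      ≈⟨ +-congˡ (+-cong (∑-δʳ j (A i)) (trans (reflexive (≡.sym (⊙-entry A B i j))) (A⊙B≈0 i j))) ⟩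
    (δ i j + B i j) + (A i j + 0#)                                    ≈⟨ +-congˡ (+-identityʳ _) ⟩
    (δ i j + B i j) + A i j                                           ≈⟨ +-assoc _ _ _ ⟩
    δ i j + (B i j + A i j)                                           ≈⟨ +-congˡ (trans (+-comm _ _) (A+B≈0 i j)) ⟩
    δ i j + 0#                                                        ≈⟨ +-identityʳ _ ⟩
    δ i j                                                             ∎
    where open ≈-Reasoning

  I+-invertible : ∀ {a} (N : Mat a a) → N ⊙ N ≈ᴹ O →
                  (I+ N) ⊙ (I+ ((- 1#) ⋆ N)) ≈ᴹ I × (I+ ((- 1#) ⋆ N)) ⊙ (I+ N) ≈ᴹ I
  I+-invertible N N⊙N≈0 =
    unipotent-inverse N ((- 1#) ⋆ N) (λ i j → trans (+-congˡ (-1*x≈-x _)) (-‿inverseʳ _))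
      (≈ᴹ-trans (⊙-⋆ (- 1#) N N) (λ i j → trans (*-congˡ (N⊙N≈0 i j)) (zeroʳ _))) ,
    unipotent-inverse ((- 1#) ⋆ N) N (λ i j → trans (+-congʳ (-1*x≈-x _)) (-‿inverseˡ _))
      (≈ᴹ-trans (⋆-⊙ (- 1#) N N) (λ i j → trans (*-congˡ (N⊙N≈0 i j)) (zeroʳ _)))

  ⊙-inverse : ∀ {a} {A A′ B B′ : Mat a a} → A ⊙ A′ ≈ᴹ I → B ⊙ B′ ≈ᴹ I → A ⊙ B ⊙ (B′ ⊙ A′) ≈ᴹ I
  ⊙-inverse {A = A} {A′} {B} {B′} A⊙A′≈I B⊙B′≈I = begin
    A ⊙ B ⊙ (B′ ⊙ A′)   ≈⟨ ⊙-assoc A B (B′ ⊙ A′) ⟩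
    A ⊙ (B ⊙ (B′ ⊙ A′)) ≈⟨ ⊙-congˡ (⊙-cancelˡ B⊙B′≈I A′) ⟩
    A ⊙ A′              ≈⟨ A⊙A′≈I ⟩
    I                   ∎
    where open ≈ᴹ-Reasoning

  conjugateDiagonals : ∀ {a p} (P Q : Mat a a) → P ⊙ Q ≈ᴹ I → Q ⊙ P ≈ᴹ I → (d : Fin p → Fin a → Carrier) →
                       let Z = λ k → (P · diag (d k)) · Q in
                       (∀ k l → (Z k · Z l) ≈ᴹ (Z l · Z k)) × (∀ k → Diagonalizable (Z k))
  conjugateDiagonals P Q P⊙Q≈I Q⊙P≈I d = commute , diagonalizable
    where
    Z : _ → Mat _ _
    Z k = (P · diag (d k)) · Q
    Z≈ : ∀ k → Z k ≈ᴹ P ⊙ diag (d k) ⊙ Q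
    Z≈ k = ≈ᴹ-sym (⊙≈·₃ P (diag (d k)) Q)
    product : ∀ k l → Z k ⊙ Z l ≈ᴹ P ⊙ (diag (d k) ⊙ diag (d l)) ⊙ Q
    product k l = begin
      Z k ⊙ Z l                                 ≈⟨ ⊙-cong (Z≈ k) (Z≈ l) ⟩
      P ⊙ diag (d k) ⊙ Q ⊙ (P ⊙ diag (d l) ⊙ Q)   ≈⟨ ⊙-assoc (P ⊙ diag (d k)) Q _ ⟩
      P ⊙ diag (d k) ⊙ (Q ⊙ (P ⊙ diag (d l) ⊙ Q)) ≈⟨ ⊙-congˡ (⊙-congˡ (⊙-assoc P (diag (d l)) Q)) ⟩
      P ⊙ diag (d k) ⊙ (Q ⊙ (P ⊙ (diag (d l) ⊙ Q))) ≈⟨ ⊙-congˡ (⊙-cancelˡ Q⊙P≈I _) ⟩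
      P ⊙ diag (d k) ⊙ (diag (d l) ⊙ Q)          ≈⟨ ⊙-assoc (P ⊙ diag (d k)) (diag (d l)) Q ⟨
      P ⊙ diag (d k) ⊙ diag (d l) ⊙ Q            ≈⟨ ⊙-congʳ (⊙-assoc P (diag (d k)) (diag (d l))) ⟩
      P ⊙ (diag (d k) ⊙ diag (d l)) ⊙ Q          ∎
      where open ≈ᴹ-Reasoning
    commute : ∀ k l → (Z k · Z l) ≈ᴹ (Z l · Z k)
    commute k l = ≈ᴹ-trans (≈ᴹ-sym (⊙≈· (Z k) (Z l))) (≈ᴹ-trans (product k l)
                    (≈ᴹ-trans (⊙-congʳ (⊙-congˡ (diag-comm (d k) (d l)))) (≈ᴹ-trans (≈ᴹ-sym (product l k)) (⊙≈· (Z l) (Z k)))))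
    diagonalizable : ∀ k → Diagonalizable (Z k)
    diagonalizable k = P , Q , diag (d k) , ≈ᴹ-trans (≈ᴹ-sym (⊙≈· P Q)) P⊙Q≈I , ≈ᴹ-trans (≈ᴹ-sym (⊙≈· Q P)) Q⊙P≈I ,
                       (λ i j i≢j → trans (*-congʳ (δ-off i≢j)) (zeroˡ _)) , ≈ᴹ-refl

  module _ {a b : ℕ} where
    upperRight : Mat a b → Mat (a ℕ.+ b) (a ℕ.+ b)
    upperRight B i j = [ (λ x → [ (λ _ → 0#) , B x ]′ (Fin.splitAt a j)) , (λ _ → 0#) ]′ (Fin.splitAt a i)

    lowerLeft : Mat b a → Mat (a ℕ.+ b) (a ℕ.+ b)
    lowerLeft C i j = [ (λ _ → 0#) , (λ l → [ C l , (λ _ → 0#) ]′ (Fin.splitAt a j)) ]′ (Fin.splitAt a i)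

    upperRight²≈O : ∀ B → upperRight B ⊙ upperRight B ≈ᴹ O
    upperRight²≈O B i j = trans (reflexive (⊙-entry _ _ i j)) (∑-zero term≈0)
      where
      term≈0 : ∀ z → upperRight B i z * upperRight B z j ≈ 0#
      term≈0 z with Fin.splitAt a i | Fin.splitAt a z
      ... | inj₁ _ | inj₁ _ = zeroˡ _
      ... | inj₁ _ | inj₂ _ = zeroʳ _
      ... | inj₂ _ | _      = zeroˡ _

    lowerLeft²≈O : ∀ C → lowerLeft C ⊙ lowerLeft C ≈ᴹ O
    lowerLeft²≈O C i j = trans (reflexive (⊙-entry _ _ i j)) (∑-zero term≈0)
      where
      term≈0 : ∀ z → lowerLeft C i z * lowerLeft C z j ≈ 0#
      term≈0 z with Fin.splitAt a i | Fin.splitAt a z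
      ... | inj₁ _ | _      = zeroˡ _
      ... | inj₂ _ | inj₁ _ = zeroʳ _
      ... | inj₂ _ | inj₂ _ = zeroˡ _

    upperRight-↑ˡ : ∀ B i y → upperRight B i (y ↑ˡ b) ≡ 0#
    upperRight-↑ˡ B i y rewrite Fin.splitAt-↑ˡ a y b with Fin.splitAt a i
    ... | inj₁ _ = ≡.refl
    ... | inj₂ _ = ≡.refl

    upperRight-↑ˡ-↑ʳ : ∀ B x l → upperRight B (x ↑ˡ b) (a ↑ʳ l) ≡ B x l
    upperRight-↑ˡ-↑ʳ B x l rewrite Fin.splitAt-↑ˡ a x b | Fin.splitAt-↑ʳ a b l = ≡.refl

    lowerLeft-↑ʳ : ∀ C i l → lowerLeft C i (a ↑ʳ l) ≡ 0#
    lowerLeft-↑ʳ C i l rewrite Fin.splitAt-↑ʳ a b l with Fin.splitAt a i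
    ... | inj₁ _ = ≡.refl
    ... | inj₂ _ = ≡.refl

    lowerLeft-↑ʳ-↑ˡ : ∀ C l y → lowerLeft C (a ↑ʳ l) (y ↑ˡ b) ≡ C l y
    lowerLeft-↑ʳ-↑ˡ C l y rewrite Fin.splitAt-↑ʳ a b l | Fin.splitAt-↑ˡ a y b = ≡.refl

  ⊙-I+-zeroColumn : ∀ {a} (A N : Mat a a) {j} → (∀ z → N z j ≈ 0#) → ∀ i → (A ⊙ (I+ N)) i j ≈ A i j
  ⊙-I+-zeroColumn {a} A N {j} Nⱼ≈0 i = begin
    (A ⊙ (I+ N)) i j                 ≡⟨ ⊙-entry A (I+ N) i j ⟩
    ∑[ z < a ] (A i z * (δ z j + N z j)) ≈⟨ sum-cong-≋ {a} (λ z → *-congˡ (trans (+-congˡ (Nⱼ≈0 z)) (+-identityʳ _))) ⟩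
    ∑[ z < a ] (A i z * δ z j)         ≈⟨ ∑-δʳ j (A i) ⟩
    A i j                            ∎
    where open ≈-Reasoning

  -- In block form P = [[I, X̃], [0, I]] [[I, 0], [-Ỹ, I]] and Q = [[I, 0], [Ỹ, I]] [[I, -X̃], [0, I]].
  module UpperBound {m n p r} (T : Tensor m n p) (u : Fin r → Fin m → Carrier) (v : Fin r → Fin n → Carrier)
                    (w : Fin r → Fin p → Carrier) (T≈ : ∀ a b k → T a b k ≈ ∑[ l < r ] ((u l a * v l b) * w l k)) where

    X̃ : Mat (m ℕ.+ n) r
    X̃ x l = [ u l , (λ _ → 0#) ]′ (Fin.splitAt m x)

    Ỹ : Mat r (m ℕ.+ n)
    Ỹ l y = [ (λ _ → 0#) , v l ]′ (Fin.splitAt m y)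

    X̃⊙w⊙Ỹ≈A : ∀ k x y → ∑[ l < r ] ((X̃ x l * w l k) * Ỹ l y) ≈ blockA T k x y
    X̃⊙w⊙Ỹ≈A k x y with Fin.splitAt m x | Fin.splitAt m y
    ... | inj₁ a | inj₂ b = trans (sum-cong-≋ {r} (λ l → xy∙z≈xz∙y (u l a) (w l k) (v l b))) (sym (T≈ a b k))
    ... | inj₁ a | inj₁ _ = ∑-zero {r} (λ l → zeroʳ (u l a * w l k))
    ... | inj₂ _ | y′     = ∑-zero {r} (λ l → trans (*-congʳ (zeroˡ (w l k))) (zeroˡ ([ (λ _ → 0#) , v l ]′ y′)))

    NU NL : Mat (m ℕ.+ n ℕ.+ r) (m ℕ.+ n ℕ.+ r)
    NU = upperRight X̃
    NL = lowerLeft Ỹ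

    P Q : Mat (m ℕ.+ n ℕ.+ r) (m ℕ.+ n ℕ.+ r)
    P = (I+ NU) ⊙ (I+ ((- 1#) ⋆ NL))
    Q = (I+ NL) ⊙ (I+ ((- 1#) ⋆ NU))

    P⊙Q≈I : P ⊙ Q ≈ᴹ I
    P⊙Q≈I = ⊙-inverse (proj₁ (I+-invertible NU (upperRight²≈O X̃))) (proj₂ (I+-invertible NL (lowerLeft²≈O Ỹ)))

    Q⊙P≈I : Q ⊙ P ≈ᴹ I
    Q⊙P≈I = ⊙-inverse (proj₁ (I+-invertible NL (lowerLeft²≈O Ỹ))) (proj₂ (I+-invertible NU (upperRight²≈O X̃)))

    P-↑ˡ-↑ʳ : ∀ x l → P (x ↑ˡ r) ((m ℕ.+ n) ↑ʳ l) ≈ X̃ x l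
    P-↑ˡ-↑ʳ x l = begin
      P (x ↑ˡ r) (_ ↑ʳ l)
        ≈⟨ ⊙-I+-zeroColumn (I+ NU) _ (λ z → trans (*-congˡ (reflexive (lowerLeft-↑ʳ Ỹ z l))) (zeroʳ _)) _ ⟩
      δ (x ↑ˡ r) (_ ↑ʳ l) + NU (x ↑ˡ r) (_ ↑ʳ l) ≈⟨ +-cong (δ-off (↑ʳ≢↑ˡ l x ∘ ≡.sym)) (reflexive (upperRight-↑ˡ-↑ʳ X̃ x l)) ⟩
      0# + X̃ x l                               ≈⟨ +-identityˡ _ ⟩
      X̃ x l                                    ∎
      where open ≈-Reasoning

    Q-↑ʳ-↑ˡ : ∀ l y → Q ((m ℕ.+ n) ↑ʳ l) (y ↑ˡ r) ≈ Ỹ l y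
    Q-↑ʳ-↑ˡ l y = begin
      Q (_ ↑ʳ l) (y ↑ˡ r)
        ≈⟨ ⊙-I+-zeroColumn (I+ NL) _ (λ z → trans (*-congˡ (reflexive (upperRight-↑ˡ X̃ z y))) (zeroʳ _)) _ ⟩
      δ (_ ↑ʳ l) (y ↑ˡ r) + NL (_ ↑ʳ l) (y ↑ˡ r) ≈⟨ +-cong (δ-off (↑ʳ≢↑ˡ l y)) (reflexive (lowerLeft-↑ʳ-↑ˡ Ỹ l y)) ⟩
      0# + Ỹ l y                               ≈⟨ +-identityˡ _ ⟩
      Ỹ l y                                    ∎
      where open ≈-Reasoning

    d : Fin p → Fin (m ℕ.+ n ℕ.+ r) → Carrier
    d k = (λ _ → 0#) ++ (λ l → w l k)

    Z : Fin p → Mat (m ℕ.+ n ℕ.+ r) (m ℕ.+ n ℕ.+ r)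
    Z k = (P · diag (d k)) · Q

    Z-topLeft : ∀ k x y → Z k (x ↑ˡ r) (y ↑ˡ r) ≈ blockA T k x y
    Z-topLeft k x y = begin
      Z k i j                                                   ≈⟨ ⊙≈·₃ P (diag (d k)) Q i j ⟨
      (P ⊙ diag (d k) ⊙ Q) i j                                  ≡⟨ ⊙-entry (P ⊙ diag (d k)) Q i j ⟩
      ∑[ z < m ℕ.+ n ℕ.+ r ] ((P ⊙ diag (d k)) i z * Q z j)      ≈⟨ sum-cong-≋ {m ℕ.+ n ℕ.+ r} (λ z → *-congʳ (⊙-diag P (d k) i z)) ⟩
      ∑[ z < m ℕ.+ n ℕ.+ r ] ((P i z * d k z) * Q z j)           ≈⟨ ∑-split (m ℕ.+ n) _ ⟩
      ∑[ x′ < m ℕ.+ n ] ((P i (x′ ↑ˡ r) * d k (x′ ↑ˡ r)) * Q (x′ ↑ˡ r) j) +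
      ∑[ l < r ] ((P i (_ ↑ʳ l) * d k (_ ↑ʳ l)) * Q (_ ↑ʳ l) j)
        ≈⟨ +-cong (∑-zero (λ x′ → trans (*-congʳ (trans (*-congˡ (reflexive (d-↑ˡ x′))) (zeroʳ _))) (zeroˡ _)))
                  (sum-cong-≋ {r} (λ l → *-cong (*-cong (P-↑ˡ-↑ʳ x l) (reflexive (d-↑ʳ l))) (Q-↑ʳ-↑ˡ l y))) ⟩
      0# + ∑[ l < r ] ((X̃ x l * w l k) * Ỹ l y)                 ≈⟨ +-identityˡ _ ⟩
      ∑[ l < r ] ((X̃ x l * w l k) * Ỹ l y)                      ≈⟨ X̃⊙w⊙Ỹ≈A k x y ⟩
      blockA T k x y                                            ∎
      where
      open ≈-Reasoning
      i = x ↑ˡ r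
      j = y ↑ˡ r
      d-↑ˡ : ∀ x′ → d k (x′ ↑ˡ r) ≡ 0#
      d-↑ˡ x′ = ≡.cong [ _ , _ ]′ (Fin.splitAt-↑ˡ (m ℕ.+ n) x′ r)
      d-↑ʳ : ∀ l → d k ((m ℕ.+ n) ↑ʳ l) ≡ w l k
      d-↑ʳ l = ≡.cong [ _ , _ ]′ (Fin.splitAt-↑ʳ (m ℕ.+ n) r l)

    extension : DiagCommExt (blockA T) (m ℕ.+ n ℕ.+ r)
    extension = ℕ.m≤m+n (m ℕ.+ n) r , Z , proj₁ conjugates , proj₂ conjugates , λ k x y →
      trans (reflexive (≡.cong₂ (Z k) (inject≤≡↑ˡ r x) (inject≤≡↑ˡ r y))) (Z-topLeft k x y)
      where conjugates = conjugateDiagonals P Q P⊙Q≈I Q⊙P≈I d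

  upperBound : ∀ {m n p r} (T : Tensor m n p) → HasDecomposition T r → DiagCommExt (blockA T) (r ℕ.+ m ℕ.+ n)
  upperBound {m} {n} {p} {r} T (u , v , w , T≈) =
    ≡.subst (DiagCommExt (blockA T)) (≡.trans (ℕ.+-comm (m ℕ.+ n) r) (≡.sym (ℕ.+-assoc r m n)))
            (UpperBound.extension T u v w (λ a b k → trans (T≈ a b k) (reflexive (∑≡sum (λ l → (u l a * v l b) * w l k)))))

open import Data.Nat using (_+_; _≤_)

proposition7p2 : ∀ {c ℓ} (K : Field c ℓ) (m n p : ℕ) (T : FieldDefs.Tensor K m n p) (r : ℕ) →
    FieldDefs.IsTensorRank K T r →
    FieldDefs.DiagCommExt K (FieldDefs.blockA K T) (r + m + n) ×
      (∀ s → FieldDefs.DiagCommExt K (FieldDefs.blockA K T) s → r + m + n ≤ s)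
proposition7p2 K m n p T r (T-decomposition , minimal) =
  upperBound K T T-decomposition , λ s → lowerBound K T minimal
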